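{- For each integer $s\ge 2$ let $Q_s(t)\in\mathbb{Q}[t]$ be a polynomial with $Q_s(0)=0$, $Q_s(1)\neq 0$ and $\deg Q_s \le s-1$, and put $Q=\{Q_s\}_{s\ge 2}$. Then \[ Z(Q,\mathbb{N}_{>1}) = \mathcal{MD}^\sharp, \] and consequently $Z(Q,\mathbb{N}_{>1})$ is a $\mathbb{Q}$-subalgebra of $\mathcal{MD}$. In particular, $q\mathcal{MZV} = \mathcal{MD}^\sharp$; hence the $\mathbb{Q}$-vector space spanned by the Okounkov $q$-multiple zeta values $\mathsf{Z}(s_1,\dots,s_l)$ is closed under multiplication.
   Context: For a family $Q=\{Q_s\}_{s\in S}$ ($S\subset\mathbb{N}$) of polynomials with $Q_s(0)=0$, $Q_s(1)\ne0$, define $Z_Q(s_1,\dots,s_l) := \sum_{n_1>\dots>n_l>0}\prod_{j=1}^l \frac{Q_{s_j}(q^{n_j})}{(1-q^{n_j})^{s_j}}\in\mathbb{Q}[[q]]$ for $s_i\in S$, $Z_Q(\emptyset)=1$, and let $Z(Q,S)$ be the $\mathbb{Q}$-span of all $Z_Q(s_1,\dots,s_l)$ with $l\ge0$, $s_i\in S$. The Eulerian polynomials are defined by $\frac{tP_{s-1}(t)}{(1-t)^s}=\sum_{d\ge1} d^{s-1}t^d$; put $Q^E_s(t)=\frac{1}{(s-1)!}tP_{s-1}(t)$ for $s\ge1$, and write $[s_1,\dots,s_l] := Z_{\{Q^E_s\}}(s_1,\dots,s_l)$ (brackets, $s_i\in\mathbb{N}$). Let $\mathcal{MD}$ be the $\mathbb{Q}$-span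 of all brackets with $s_i\in\mathbb{N}$ (a $\mathbb{Q}$-algebra), and $\mathcal{MD}^\sharp$ the $\mathbb{Q}$-span of $1$ and all brackets $[s_1,\dots,s_l]$ with all $s_i\ge2$. Okounkov's polynomials are, for $s\ge2$: $Q^O_s(t)=t^{s/2}$ if $s$ is even and $Q^O_s(t)=t^{(s-1)/2}(1+t)$ if $s$ is odd; $\mathsf{Z}(s_1,\dots,s_l):=Z_{\{Q^O_s\}}(s_1,\dots,s_l)$ for $s_i\ge 2$, and $q\mathcal{MZV}:=Z(\{Q^O_s\}_{s\ge2},\mathbb{N}_{>1})$. -}

module Defs where

open import Data.Nat as ℕ using (ℕ; zero; suc; _∸_; _≡ᵇ_; _!; _≤_)
open import Data.Nat.Properties using (_!≢0)
open import Data.Integer as ℤ using (ℤ)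
open import Data.Rational using (ℚ; 0ℚ; 1ℚ; _+_; _*_; -_; _/_)
open import Data.Bool using (if_then_else_)
open import Data.List using (List; []; _∷_; map; foldr; upTo)
open import Data.List.Relation.Unary.All using (All)
open import Data.Product using (Σ; _×_; _,_; proj₁; proj₂)
open import Relation.Binary.PropositionalEquality using (_≡_)

sumTo : ℕ → (ℕ → ℚ) → ℚ
sumTo zero    f = 0ℚ
sumTo (suc n) f = sumTo n f + f n

PS : Set
PS = ℕ → ℚ

_≈ₚ_ : PS → PS → Set
f ≈ₚ g = ∀ N → f N ≡ g N

oneP : PS
oneP zero    = 1ℚ
oneP (suc _) = 0ℚ

_⊛_ : PS → PS → PS
(f ⊛ g) N = sumTo (suc N) (λ i → f i * g (N ∸ i))

powP : PS → ℕ → PS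
powP f zero    = oneP
powP f (suc s) = f ⊛ powP f s

-- geometric series 1/(1-t) = Σ_{m≥0} t^m
geomP : PS
geomP _ = 1ℚ

oneMinusT : PS
oneMinusT zero          = 1ℚ
oneMinusT (suc zero)    = - 1ℚ
oneMinusT (suc (suc _)) = 0ℚ

-- substitution t ↦ q^n in a power series G(t):  coefficient of q^N of G(q^n)
substPow : ℕ → PS → PS
substPow n G N = sumTo (suc N) (λ M → if (n ℕ.* M) ≡ᵇ N then G M else 0ℚ)

-- Polynomials over ℚ as coefficient lists (constant term first)

Poly : Set
Poly = List ℚ

coeff : Poly → ℕ → ℚ
coeff []       _       = 0ℚ
coeff (c ∷ p)  zero    = c
coeff (c ∷ p)  (suc k) = coeff p k

evalAt1 : Poly → ℚ
evalAt1 = foldr _+_ 0ℚ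

polyP : Poly → PS
polyP = coeff

-- The series  Q(q^n) / (1 - q^n)^s  as an element of ℚ[[q]]
-- (1/(1-t)^s is the s-fold product of the geometric series)

factorP : Poly → ℕ → ℕ → PS
factorP Q s n = substPow n (polyP Q ⊛ powP geomP s)

-- Z_Q(s_1,...,s_l) = Σ_{n_1 > ... > n_l > 0} Π_j Q_{s_j}(q^{n_j}) / (1-q^{n_j})^{s_j}

-- ZLess Q l m : the same sum restricted to m > n_1 (a finite sum)
ZLess : (ℕ → Poly) → List ℕ → ℕ → PS
ZLess Q []      m = oneP
ZLess Q (s ∷ l) m N =
  sumTo m (λ { zero → 0ℚ ; n@(suc _) → (factorP (Q s) s n ⊛ ZLess Q l n) N })

-- Coefficient of q^N of Z_Q(l).  Since Q_s(0) = 0, the term with index n_1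
-- has q-order ≥ n_1, so only n_1 ≤ N contributes to the coefficient of q^N.
ZQ : (ℕ → Poly) → List ℕ → PS
ZQ Q l N = ZLess Q l (suc N) N

linComb : (List ℕ → PS) → List (ℚ × List ℕ) → PS
linComb gen []             N = 0ℚ
linComb gen ((c , i) ∷ cs) N = c * gen i N + linComb gen cs N

InSpan : (List ℕ → PS) → (List ℕ → Set) → PS → Set
InSpan gen P f =
  Σ (List (ℚ × List ℕ)) λ cs → All (λ ci → P (proj₂ ci)) cs × (f ≈ₚ linComb gen cs)

AllGe2 : List ℕ → Set
AllGe2 = All (λ s → 2 ≤ s)

AllGe1 : List ℕ → Set
AllGe1 = All (λ s → 1 ≤ s)

ZSpan : (ℕ → Poly) → PS → Set
ZSpan Q = InSpan (ZQ Q) AllGe2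

-- Eulerian polynomials:  t P_{s-1}(t) / (1-t)^s = Σ_{d≥1} d^{s-1} t^d,
-- so  t P_{s-1}(t) = (1-t)^s · Σ_{d≥1} d^{s-1} t^d , a polynomial of degree ≤ s.

eulSeries : ℕ → PS
eulSeries s zero      = 0ℚ
eulSeries s d@(suc _) = (ℤ.+ (d ℕ.^ (s ∸ 1))) / 1

-- coefficients (degrees 0..s) of t P_{s-1}(t)
tEulerian : ℕ → Poly
tEulerian s = map (powP oneMinusT s ⊛ eulSeries s) (upTo (suc s))

QE : ℕ → Poly
QE s = map (λ c → c * ((ℤ.+ 1) / ((s ∸ 1) !)) {{(s ∸ 1) !≢0}}) (tEulerian s)

bracket : List ℕ → PS
bracket = ZQ QE

MD : PS → Set
MD = InSpan bracket AllGe1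

-- 𝓜𝓓♯ : span of 1 = [] and all brackets with all s_i ≥ 2
MDsharp : PS → Set
MDsharp = InSpan bracket AllGe2

-- Okounkov's polynomials: t^{s/2} (s even), t^{(s-1)/2}(1+t) (s odd)

QO : ℕ → Poly
QO zero          = 1ℚ ∷ []
QO (suc zero)    = 1ℚ ∷ 1ℚ ∷ []
QO (suc (suc s)) = 0ℚ ∷ QO s

qMZV : PS → Set
qMZV = ZSpan QO

module Submission where

-- Write C_k(t) = t/(1-t)^k and L_s = Q_s(t)/(1-t)^s.  The sum Z_Q(s_1,…,s_l)
-- is the iterated sum of the "letters" L_{s_j}(q^{n_j}), and this iterated
-- sum is multilinear in the letters.  If Q_s(0) = 0, Q_s(1) ≠ 0 and
-- deg Q_s < s, then L_s = Q_s(1)·C_s + (a combination of C_k, 2 ≤ k < s),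
-- a triangular change of basis; hence the letters {L_s} and {C_s} (s ≥ 2)
-- span the same space and Z(Q, ℕ_{>1}) equals the span 𝓒 of the iterated
-- sums of C-words, independently of Q.  Brackets and Okounkov's q-MZVs are
-- the cases Q = Q^E and Q = Q^O, so both coincide with 𝓒 = 𝓜𝓓♯.  Finally 𝓒
-- is closed under products: iterated sums multiply by the stuffle
-- (quasi-shuffle) rule, and C_a C_b = C_{a+b} - C_{a+b-1}.

open import Defs
open import Data.Nat as ℕ using (ℕ; zero; suc; _≤_; _<_; z≤n; s≤s; _∸_; _≡ᵇ_; _^_; _!)
import Data.Nat.Properties as ℕP
import Data.Integer as ℤ
import Data.Integer.Solver as ℤSolver
open import Data.Rational using (ℚ; 0ℚ; 1ℚ; _+_; _*_; -_; _-_; _/_; 1/_; mkℚ; toℚᵘ; NonZero; Positive; ≢-nonZero) renaming (_<_ to _<ℚ_)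
import Data.Rational.Properties as QP
import Data.Rational.Unnormalised as U
import Data.Rational.Unnormalised.Properties as UP
open import Data.Rational.Solver using (module +-*-Solver)
import Data.Nat.Coprimality as Coprimality
open import Data.Bool using (true; false; if_then_else_)
open import Data.Unit using (tt)
open import Data.Empty using (⊥-elim)
open import Data.List using (List; []; _∷_; map; _++_; applyUpTo; upTo)
import Data.List.Properties as ListP
open import Data.List.Relation.Unary.All as All using (All; []; _∷_)
import Data.List.Relation.Unary.All.Properties as AllP
open import Data.Product using (Σ; _×_; _,_; proj₁; proj₂)
open import Relation.Binary.PropositionalEquality
open import Relation.Binary.Bundles using (Setoid)
import Relation.Binary.Reasoning.Setoid as SetoidReasoning
open import Relation.Nullary using (Dec; yes; no)
open import Function using (_∘_; id)

open +-*-Solver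

0+ : ∀ x → 0ℚ + x ≡ x
0+ = QP.+-identityˡ

+0 : ∀ x → x + 0ℚ ≡ x
+0 = QP.+-identityʳ

0* : ∀ x → 0ℚ * x ≡ 0ℚ
0* = QP.*-zeroˡ

*0 : ∀ x → x * 0ℚ ≡ 0ℚ
*0 = QP.*-zeroʳ

sumTo-cong : ∀ n {f g : ℕ → ℚ} → (∀ i → i < n → f i ≡ g i) → sumTo n f ≡ sumTo n g
sumTo-cong zero    h = refl
sumTo-cong (suc n) h = cong₂ _+_ (sumTo-cong n (λ i i<n → h i (ℕP.m<n⇒m<1+n i<n))) (h n ℕP.≤-refl)

sumTo-ext : ∀ n {f g : ℕ → ℚ} → (∀ i → f i ≡ g i) → sumTo n f ≡ sumTo n g
sumTo-ext n h = sumTo-cong n (λ i _ → h i)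

sumTo-+ : ∀ n (f g : ℕ → ℚ) → sumTo n (λ i → f i + g i) ≡ sumTo n f + sumTo n g
sumTo-+ zero    f g = sym (0+ 0ℚ)
sumTo-+ (suc n) f g rewrite sumTo-+ n f g =
  solve 4 (λ a b c d → (a :+ b) :+ (c :+ d) := (a :+ c) :+ (b :+ d)) refl
    (sumTo n f) (sumTo n g) (f n) (g n)

sumTo-*l : ∀ n c (f : ℕ → ℚ) → sumTo n (λ i → c * f i) ≡ c * sumTo n f
sumTo-*l zero    c f = sym (*0 c)
sumTo-*l (suc n) c f rewrite sumTo-*l n c f = sym (QP.*-distribˡ-+ c (sumTo n f) (f n))

sumTo-*r : ∀ n c (f : ℕ → ℚ) → sumTo n (λ i → f i * c) ≡ sumTo n f * c
sumTo-*r n c f =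
  trans (sumTo-ext n (λ i → QP.*-comm (f i) c)) (trans (sumTo-*l n c f) (QP.*-comm c _))

sumTo-neg : ∀ n (f : ℕ → ℚ) → sumTo n (λ i → - f i) ≡ - sumTo n f
sumTo-neg zero    f = refl
sumTo-neg (suc n) f rewrite sumTo-neg n f = sym (QP.neg-distrib-+ (sumTo n f) (f n))

sumTo-zero : ∀ n {f : ℕ → ℚ} → (∀ i → i < n → f i ≡ 0ℚ) → sumTo n f ≡ 0ℚ
sumTo-zero zero    h = refl
sumTo-zero (suc n) h
  rewrite sumTo-zero n (λ i i<n → h i (ℕP.m<n⇒m<1+n i<n)) | h n ℕP.≤-refl = refl

sumTo-peel : ∀ n (f : ℕ → ℚ) → sumTo (suc n) f ≡ f 0 + sumTo n (f ∘ suc)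
sumTo-peel zero    f = trans (0+ (f 0)) (sym (+0 (f 0)))
sumTo-peel (suc n) f rewrite sumTo-peel n f = QP.+-assoc (f 0) _ _

sumTo-single : ∀ n j {f : ℕ → ℚ} → j < n → (∀ i → i < n → i ≢ j → f i ≡ 0ℚ) →
               sumTo n f ≡ f j
sumTo-single (suc n) j {f} j<sn h with j ℕP.≟ n
... | yes refl =
  trans (cong (_+ f n) (sumTo-zero n (λ i i<n → h i (ℕP.m<n⇒m<1+n i<n) (λ e → ℕP.<-irrefl e i<n))))
        (0+ (f n))
... | no j≢n =
  trans (cong₂ _+_ (sumTo-single n j (ℕP.≤∧≢⇒< (ℕP.≤-pred j<sn) j≢n) (λ i i<n → h i (ℕP.m<n⇒m<1+n i<n)))
                   (h n ℕP.≤-refl (λ e → j≢n (sym e))))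
        (+0 (f j))

sumTo-extend : ∀ a b {f : ℕ → ℚ} → a ≤ b → (∀ i → a ≤ i → i < b → f i ≡ 0ℚ) →
               sumTo b f ≡ sumTo a f
sumTo-extend a zero    z≤n h = refl
sumTo-extend a (suc b) a≤sb h with a ℕP.≟ suc b
... | yes refl = refl
... | no a≢sb =
  trans (cong₂ _+_ (sumTo-extend a b a≤b (λ i a≤i i<b → h i a≤i (ℕP.m<n⇒m<1+n i<b))) (h b a≤b ℕP.≤-refl))
        (+0 (sumTo a _))
  where a≤b = ℕP.≤-pred (ℕP.≤∧≢⇒< a≤sb a≢sb)

sumTo-rev : ∀ N (f : ℕ → ℚ) → sumTo (suc N) f ≡ sumTo (suc N) (λ i → f (N ∸ i))
sumTo-rev zero    f = refl
sumTo-rev (suc N) f = begin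
  sumTo (suc (suc N)) f                          ≡⟨ sumTo-peel (suc N) f ⟩
  f 0 + sumTo (suc N) (f ∘ suc)                  ≡⟨ cong (f 0 +_) (sumTo-rev N (f ∘ suc)) ⟩
  f 0 + sumTo (suc N) (λ i → f (suc (N ∸ i)))    ≡⟨ QP.+-comm (f 0) _ ⟩
  sumTo (suc N) (λ i → f (suc (N ∸ i))) + f 0    ≡⟨ cong₂ _+_ (sumTo-cong (suc N) shift) (cong f (sym (ℕP.n∸n≡0 N))) ⟩
  sumTo (suc (suc N)) (λ i → f (suc N ∸ i))      ∎
  where
  open ≡-Reasoning
  shift : ∀ i → i < suc N → f (suc (N ∸ i)) ≡ f (suc N ∸ i)
  shift i i<sN = cong f (sym (ℕP.+-∸-assoc 1 (ℕP.≤-pred i<sN)))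

sumTo-swap : ∀ n m (a : ℕ → ℕ → ℚ) →
             sumTo n (λ i → sumTo m (a i)) ≡ sumTo m (λ j → sumTo n (λ i → a i j))
sumTo-swap zero    m a = sym (sumTo-zero m (λ _ _ → refl))
sumTo-swap (suc n) m a rewrite sumTo-swap n m a =
  sym (sumTo-+ m (λ j → sumTo n (λ i → a i j)) (a n))

sumTo-tri : ∀ n (a : ℕ → ℕ → ℚ) →
            sumTo n (λ i → sumTo (suc i) (a i)) ≡ sumTo n (λ j → sumTo (n ∸ j) (λ k → a (j ℕ.+ k) j))
sumTo-tri zero    a = refl
sumTo-tri (suc n) a = begin
  sumTo n (λ i → sumTo (suc i) (a i)) + sumTo (suc n) (a n)   ≡⟨ cong (_+ sumTo (suc n) (a n)) (sumTo-tri n a) ⟩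
  R + (sumTo n (a n) + a n n)                                 ≡⟨ sym (QP.+-assoc R _ _) ⟩
  (R + sumTo n (a n)) + a n n                                 ≡⟨ cong₂ _+_ (sym (sumTo-+ n _ _)) (sym lastColumn) ⟩
  sumTo n (λ j → column n j + a n j) + column (suc n) n
    ≡⟨ cong (_+ column (suc n) n) (sumTo-cong n λ j j<n → sym (growColumn j j<n)) ⟩
  sumTo (suc n) (column (suc n))                              ∎
  where
  open ≡-Reasoning
  column : ℕ → ℕ → ℚ
  column m j = sumTo (m ∸ j) (λ k → a (j ℕ.+ k) j)
  R : ℚ
  R = sumTo n (column n)
  lastColumn : column (suc n) n ≡ a n n
  lastColumn rewrite ℕP.+-∸-assoc 1 (ℕP.≤-refl {n}) | ℕP.n∸n≡0 n | ℕP.+-identityʳ n = 0+ (a n n)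
  growColumn : ∀ j → j < n → column (suc n) j ≡ column n j + a n j
  growColumn j j<n rewrite ℕP.+-∸-assoc 1 (ℕP.<⇒≤ j<n) =
    cong (column n j +_) (cong (λ z → a z j) (ℕP.m+[n∸m]≡n (ℕP.<⇒≤ j<n)))

infixl 6 _+ₚ_ _-ₚ_
infixl 7 _·ₚ_

_+ₚ_ : PS → PS → PS
(f +ₚ g) N = f N + g N

_·ₚ_ : ℚ → PS → PS
(c ·ₚ f) N = c * f N

zeroP : PS
zeroP _ = 0ℚ

negP : PS → PS
negP f N = - f N

_-ₚ_ : PS → PS → PS
f -ₚ g = f +ₚ negP g

≈-refl : ∀ {f} → f ≈ₚ f
≈-refl N = refl

≈-sym : ∀ {f g} → f ≈ₚ g → g ≈ₚ f
≈-sym e N = sym (e N)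

≈-trans : ∀ {f g h} → f ≈ₚ g → g ≈ₚ h → f ≈ₚ h
≈-trans e e′ N = trans (e N) (e′ N)

PS-setoid : Setoid _ _
PS-setoid = record
  { Carrier = PS ; _≈_ = _≈ₚ_
  ; isEquivalence = record { refl = ≈-refl ; sym = ≈-sym ; trans = ≈-trans } }

module ≈-Reasoning = SetoidReasoning PS-setoid

+ₚ-cong : ∀ {f f′ g g′} → f ≈ₚ f′ → g ≈ₚ g′ → (f +ₚ g) ≈ₚ (f′ +ₚ g′)
+ₚ-cong e e′ N = cong₂ _+_ (e N) (e′ N)

·ₚ-cong : ∀ c {f f′} → f ≈ₚ f′ → (c ·ₚ f) ≈ₚ (c ·ₚ f′)
·ₚ-cong c e N = cong (c *_) (e N)

⊛-cong : ∀ {f f′ g g′} → f ≈ₚ f′ → g ≈ₚ g′ → (f ⊛ g) ≈ₚ (f′ ⊛ g′)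
⊛-cong e e′ N = sumTo-ext (suc N) (λ i → cong₂ _*_ (e i) (e′ (N ∸ i)))

⊛-bounded : ∀ N {f f′ g g′} → (∀ i → i ≤ N → f i ≡ f′ i) → (∀ i → i ≤ N → g i ≡ g′ i) →
            (f ⊛ g) N ≡ (f′ ⊛ g′) N
⊛-bounded N e e′ =
  sumTo-cong (suc N) (λ i i<sN → cong₂ _*_ (e i (ℕP.≤-pred i<sN)) (e′ (N ∸ i) (ℕP.m∸n≤m N i)))

⊛-comm : ∀ f g → (f ⊛ g) ≈ₚ (g ⊛ f)
⊛-comm f g N = trans (sumTo-rev N _) (sumTo-cong (suc N) λ i i<sN →
  trans (QP.*-comm (f (N ∸ i)) _) (cong (λ z → g z * f (N ∸ i)) (ℕP.m∸[m∸n]≡n (ℕP.≤-pred i<sN))))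

⊛-distribʳ : ∀ f g h → ((f +ₚ g) ⊛ h) ≈ₚ ((f ⊛ h) +ₚ (g ⊛ h))
⊛-distribʳ f g h N =
  trans (sumTo-ext (suc N) (λ i → QP.*-distribʳ-+ (h (N ∸ i)) (f i) (g i))) (sumTo-+ (suc N) _ _)

⊛-distribˡ : ∀ f g h → (h ⊛ (f +ₚ g)) ≈ₚ ((h ⊛ f) +ₚ (h ⊛ g))
⊛-distribˡ f g h N =
  trans (sumTo-ext (suc N) (λ i → QP.*-distribˡ-+ (h i) (f (N ∸ i)) (g (N ∸ i)))) (sumTo-+ (suc N) _ _)

⊛-scaleˡ : ∀ c f g → ((c ·ₚ f) ⊛ g) ≈ₚ (c ·ₚ (f ⊛ g))
⊛-scaleˡ c f g N =
  trans (sumTo-ext (suc N) (λ i → QP.*-assoc c (f i) (g (N ∸ i)))) (sumTo-*l (suc N) c _)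

⊛-scaleʳ : ∀ c f g → (f ⊛ (c ·ₚ g)) ≈ₚ (c ·ₚ (f ⊛ g))
⊛-scaleʳ c f g N = trans (sumTo-ext (suc N) (λ i →
  solve 3 (λ x y z → x :* (y :* z) := y :* (x :* z)) refl (f i) c (g (N ∸ i)))) (sumTo-*l (suc N) c _)

⊛-negˡ : ∀ f g → (negP f ⊛ g) ≈ₚ negP (f ⊛ g)
⊛-negˡ f g N =
  trans (sumTo-ext (suc N) (λ i → sym (QP.neg-distribˡ-* (f i) (g (N ∸ i))))) (sumTo-neg (suc N) _)

⊛-negʳ : ∀ f g → (f ⊛ negP g) ≈ₚ negP (f ⊛ g)
⊛-negʳ f g N =
  trans (sumTo-ext (suc N) (λ i → sym (QP.neg-distribʳ-* (f i) (g (N ∸ i))))) (sumTo-neg (suc N) _)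

⊛-zeroˡ : ∀ f → (zeroP ⊛ f) ≈ₚ zeroP
⊛-zeroˡ f N = sumTo-zero (suc N) (λ i _ → 0* (f (N ∸ i)))

⊛-zeroʳ : ∀ f → (f ⊛ zeroP) ≈ₚ zeroP
⊛-zeroʳ f N = sumTo-zero (suc N) (λ i _ → *0 (f i))

⊛-identityˡ : ∀ f → (oneP ⊛ f) ≈ₚ f
⊛-identityˡ f N = trans (sumTo-peel N _)
  (trans (cong₂ _+_ (QP.*-identityˡ (f N)) (sumTo-zero N (λ i _ → 0* (f (N ∸ suc i))))) (+0 (f N)))

⊛-identityʳ : ∀ f → (f ⊛ oneP) ≈ₚ f
⊛-identityʳ f = ≈-trans (⊛-comm f oneP) (⊛-identityˡ f)

⊛-assoc : ∀ f g h → ((f ⊛ g) ⊛ h) ≈ₚ (f ⊛ (g ⊛ h))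
⊛-assoc f g h N = begin
  sumTo (suc N) (λ i → sumTo (suc i) (λ j → f j * g (i ∸ j)) * h (N ∸ i))
    ≡⟨ sumTo-ext (suc N) (λ i → sym (sumTo-*r (suc i) (h (N ∸ i)) _)) ⟩
  sumTo (suc N) (λ i → sumTo (suc i) (λ j → f j * g (i ∸ j) * h (N ∸ i)))
    ≡⟨ sumTo-tri (suc N) (λ i j → f j * g (i ∸ j) * h (N ∸ i)) ⟩
  sumTo (suc N) (λ j → sumTo (suc N ∸ j) (λ k → f j * g ((j ℕ.+ k) ∸ j) * h (N ∸ (j ℕ.+ k))))
    ≡⟨ sumTo-cong (suc N) (λ j j<sN → inner j (ℕP.≤-pred j<sN)) ⟩
  sumTo (suc N) (λ j → f j * sumTo (suc (N ∸ j)) (λ k → g k * h ((N ∸ j) ∸ k)))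
    ∎
  where
  open ≡-Reasoning
  inner : ∀ j → j ≤ N → sumTo (suc N ∸ j) (λ k → f j * g ((j ℕ.+ k) ∸ j) * h (N ∸ (j ℕ.+ k)))
                      ≡ f j * sumTo (suc (N ∸ j)) (λ k → g k * h ((N ∸ j) ∸ k))
  inner j j≤N rewrite ℕP.+-∸-assoc 1 j≤N =
    trans (sumTo-ext (suc (N ∸ j)) (λ k → trans (QP.*-assoc (f j) _ _)
             (cong₂ (λ a b → f j * (g a * h b)) (ℕP.m+n∸m≡n j k) (sym (ℕP.∸-+-assoc N j k)))))
          (sumTo-*l (suc (N ∸ j)) (f j) _)

⊛-interchange : ∀ a x b y → ((a ⊛ x) ⊛ (b ⊛ y)) ≈ₚ ((a ⊛ b) ⊛ (x ⊛ y))
⊛-interchange a x b y = begin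
  (a ⊛ x) ⊛ (b ⊛ y)   ≈⟨ ⊛-assoc a x (b ⊛ y) ⟩
  a ⊛ (x ⊛ (b ⊛ y))   ≈⟨ ⊛-cong (≈-refl {a}) (≈-sym (⊛-assoc x b y)) ⟩
  a ⊛ ((x ⊛ b) ⊛ y)   ≈⟨ ⊛-cong (≈-refl {a}) (⊛-cong (⊛-comm x b) (≈-refl {y})) ⟩
  a ⊛ ((b ⊛ x) ⊛ y)   ≈⟨ ⊛-cong (≈-refl {a}) (⊛-assoc b x y) ⟩
  a ⊛ (b ⊛ (x ⊛ y))   ≈⟨ ≈-sym (⊛-assoc a b (x ⊛ y)) ⟩
  (a ⊛ b) ⊛ (x ⊛ y)   ∎
  where open ≈-Reasoning

record IsLinear (Φ : PS → PS) : Set where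
  field
    ≈-cong  : ∀ {f g} → f ≈ₚ g → Φ f ≈ₚ Φ g
    +-hom  : ∀ f g → Φ (f +ₚ g) ≈ₚ (Φ f +ₚ Φ g)
    ·-hom  : ∀ c f → Φ (c ·ₚ f) ≈ₚ (c ·ₚ Φ f)
    0-hom  : Φ zeroP ≈ₚ zeroP

⊛-linearˡ : ∀ h → IsLinear (_⊛ h)
⊛-linearˡ h = record
  { ≈-cong = λ e → ⊛-cong e (≈-refl {h}) ; +-hom = λ f g → ⊛-distribʳ f g h
  ; ·-hom = λ c f → ⊛-scaleˡ c f h ; 0-hom = ⊛-zeroˡ h }

⊛-linearʳ : ∀ h → IsLinear (h ⊛_)
⊛-linearʳ h = record
  { ≈-cong = λ e → ⊛-cong (≈-refl {h}) e ; +-hom = λ f g → ⊛-distribˡ f g h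
  ; ·-hom = λ c f → ⊛-scaleʳ c h f ; 0-hom = ⊛-zeroʳ h }

δ : ℕ → ℕ → ℚ
δ a b = if a ≡ᵇ b then 1ℚ else 0ℚ

δ-diag : ∀ a → δ a a ≡ 1ℚ
δ-diag a with a ≡ᵇ a | ℕP.≡⇒≡ᵇ a a refl
... | true  | _ = refl
... | false | ()

δ-off : ∀ a b → a ≢ b → δ a b ≡ 0ℚ
δ-off a b a≢b with a ≡ᵇ b | ℕP.≡ᵇ⇒≡ a b
... | true  | a≡b = ⊥-elim (a≢b (a≡b tt))
... | false | _   = refl

δ-big : ∀ a b → b < a → δ a b ≡ 0ℚ
δ-big a b b<a = δ-off a b (λ e → ℕP.<-irrefl (sym e) b<a)

δ-shift : ∀ a b N → a ≤ N → δ b (N ∸ a) ≡ δ (a ℕ.+ b) N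
δ-shift a b N a≤N with b ℕP.≟ N ∸ a
... | yes refl =
  trans (δ-diag (N ∸ a)) (sym (trans (cong (λ z → δ z N) (ℕP.m+[n∸m]≡n a≤N)) (δ-diag N)))
... | no b≢ =
  trans (δ-off b (N ∸ a) b≢)
        (sym (δ-off (a ℕ.+ b) N λ e → b≢ (trans (sym (ℕP.m+n∸m≡n a b)) (cong (_∸ a) e))))

δ-convolution : ∀ a b N → sumTo (suc N) (λ i → δ a i * δ b (N ∸ i)) ≡ δ (a ℕ.+ b) N
δ-convolution a b N with a ℕ.≤? N
... | yes a≤N =
  trans (sumTo-single (suc N) a (s≤s a≤N) offDiagonal)
        (trans (cong (_* δ b (N ∸ a)) (δ-diag a)) (trans (QP.*-identityˡ (δ b (N ∸ a))) (δ-shift a b N a≤N)))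
  where
  offDiagonal : ∀ i → i < suc N → i ≢ a → δ a i * δ b (N ∸ i) ≡ 0ℚ
  offDiagonal i _ i≢a = trans (cong (_* δ b (N ∸ i)) (δ-off a i (λ e → i≢a (sym e)))) (0* (δ b (N ∸ i)))
... | no a≰N =
  trans (sumTo-zero (suc N) (λ i i<sN →
           trans (cong (_* δ b (N ∸ i)) (δ-big a i (ℕP.≤-<-trans (ℕP.≤-pred i<sN) (ℕP.≰⇒> a≰N)))) (0* (δ b (N ∸ i)))))
        (sym (δ-big (a ℕ.+ b) N (ℕP.<-≤-trans (ℕP.≰⇒> a≰N) (ℕP.m≤m+n a b))))

if-δ : ∀ a b x → (if a ≡ᵇ b then x else 0ℚ) ≡ δ a b * x
if-δ a b x with a ≡ᵇ b
... | true  = sym (QP.*-identityˡ x)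
... | false = sym (0* x)

substPow-δ : ∀ n G N → substPow n G N ≡ sumTo (suc N) (λ M → δ (n ℕ.* M) N * G M)
substPow-δ n G N = sumTo-ext (suc N) (λ M → if-δ (n ℕ.* M) N (G M))

substPow-range : ∀ n f N i → i ≤ N →
                 substPow (suc n) f i ≡ sumTo (suc N) (λ M → δ (suc n ℕ.* M) i * f M)
substPow-range n f N i i≤N = trans (substPow-δ (suc n) f i)
  (sym (sumTo-extend (suc i) (suc N) (s≤s i≤N) (λ M si≤M _ →
     trans (cong (_* f M) (δ-big (suc n ℕ.* M) i (ℕP.<-≤-trans si≤M (ℕP.m≤n*m M (suc n))))) (0* (f M)))))

substPow-low : ∀ n f i → f 0 ≡ 0ℚ → i < n → substPow n f i ≡ 0ℚ
substPow-low n f i f0 i<n = sumTo-zero (suc i) (λ M _ → term M)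
  where
  term : ∀ M → (if n ℕ.* M ≡ᵇ i then f M else 0ℚ) ≡ 0ℚ
  term zero rewrite ℕP.*-zeroʳ n = trans (if-δ 0 i (f 0)) (trans (cong (δ 0 i *_) f0) (*0 (δ 0 i)))
  term (suc M) = trans (if-δ (n ℕ.* suc M) i (f (suc M)))
    (trans (cong (_* f (suc M)) (δ-big (n ℕ.* suc M) i (ℕP.<-≤-trans i<n (ℕP.m≤m*n n (suc M))))) (0* (f (suc M))))

substPow-linear : ∀ n → IsLinear (substPow n)
substPow-linear n = record
  { ≈-cong = λ e N → sumTo-ext (suc N) (λ M → cong (if n ℕ.* M ≡ᵇ N then_else 0ℚ) (e M))
  ; +-hom  = λ f g N → trans (substPow-δ n _ N)
      (trans (trans (sumTo-ext (suc N) (λ M → QP.*-distribˡ-+ (δ (n ℕ.* M) N) (f M) (g M))) (sumTo-+ (suc N) _ _))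
             (sym (cong₂ _+_ (substPow-δ n f N) (substPow-δ n g N))))
  ; ·-hom  = λ c f N → trans (substPow-δ n _ N)
      (trans (trans (sumTo-ext (suc N) (λ M → solve 3 (λ d x y → d :* (x :* y) := x :* (d :* y)) refl
                                                 (δ (n ℕ.* M) N) c (f M)))
                    (sumTo-*l (suc N) c _))
             (sym (cong (c *_) (substPow-δ n f N))))
  ; 0-hom  = λ N → trans (substPow-δ n _ N) (sumTo-zero (suc N) (λ M _ → *0 (δ (n ℕ.* M) N))) }

substPow-⊛ : ∀ n′ f g → substPow (suc n′) (f ⊛ g) ≈ₚ (substPow (suc n′) f ⊛ substPow (suc n′) g)
substPow-⊛ n′ f g N = sym (begin
  sumTo (suc N) (λ i → substPow n f i * substPow n g (N ∸ i))
    ≡⟨ sumTo-cong (suc N) (λ i i<sN → cong₂ _*_ (substPow-range n′ f N i (ℕP.≤-pred i<sN))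
                                               (substPow-range n′ g N (N ∸ i) (ℕP.m∸n≤m N i))) ⟩
  sumTo (suc N) (λ i → sumTo (suc N) (λ M → δ (n ℕ.* M) i * f M) * B i)
    ≡⟨ sumTo-ext (suc N) (λ i → trans (sym (sumTo-*r (suc N) (B i) _))
                                 (sumTo-ext (suc N) (λ M → sym (sumTo-*l (suc N) (δ (n ℕ.* M) i * f M)
                                                                         (λ M′ → δ (n ℕ.* M′) (N ∸ i) * g M′))))) ⟩
  sumTo (suc N) (λ i → sumTo (suc N) (λ M → sumTo (suc N) (λ M′ → X i M M′)))
    ≡⟨ sumTo-swap (suc N) (suc N) _ ⟩
  sumTo (suc N) (λ M → sumTo (suc N) (λ i → sumTo (suc N) (λ M′ → X i M M′)))
    ≡⟨ sumTo-ext (suc N) (λ M → sumTo-swap (suc N) (suc N) _) ⟩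
  sumTo (suc N) (λ M → sumTo (suc N) (λ M′ → sumTo (suc N) (λ i → X i M M′)))
    ≡⟨ sumTo-ext (suc N) (λ M → sumTo-ext (suc N) (λ M′ → convolve M M′)) ⟩
  sumTo (suc N) (λ M → sumTo (suc N) (λ k → δ (n ℕ.* M ℕ.+ n ℕ.* k) N * (f M * g k)))
    ≡⟨ sumTo-cong (suc N) (λ M M<sN → sym (reindex M (ℕP.≤-pred M<sN))) ⟩
  sumTo (suc N) (λ M → sumTo (suc N ∸ M) (λ k → δ (n ℕ.* (M ℕ.+ k)) N * (f M * g ((M ℕ.+ k) ∸ M))))
    ≡⟨ sym (sumTo-tri (suc N) (λ K M → δ (n ℕ.* K) N * (f M * g (K ∸ M)))) ⟩
  sumTo (suc N) (λ K → sumTo (suc K) (λ M → δ (n ℕ.* K) N * (f M * g (K ∸ M))))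
    ≡⟨ sumTo-ext (suc N) (λ K → sumTo-*l (suc K) (δ (n ℕ.* K) N) (λ M → f M * g (K ∸ M))) ⟩
  sumTo (suc N) (λ K → δ (n ℕ.* K) N * (f ⊛ g) K)
    ≡⟨ sym (substPow-δ n (f ⊛ g) N) ⟩
  substPow n (f ⊛ g) N ∎)
  where
  open ≡-Reasoning
  n = suc n′
  B : ℕ → ℚ
  B i = sumTo (suc N) (λ M′ → δ (n ℕ.* M′) (N ∸ i) * g M′)
  X : ℕ → ℕ → ℕ → ℚ
  X i M M′ = (δ (n ℕ.* M) i * f M) * (δ (n ℕ.* M′) (N ∸ i) * g M′)
  convolve : ∀ M M′ → sumTo (suc N) (λ i → X i M M′) ≡ δ (n ℕ.* M ℕ.+ n ℕ.* M′) N * (f M * g M′)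
  convolve M M′ = trans (sumTo-ext (suc N) (λ i →
      solve 4 (λ a x b y → (a :* x) :* (b :* y) := (a :* b) :* (x :* y)) refl
        (δ (n ℕ.* M) i) (f M) (δ (n ℕ.* M′) (N ∸ i)) (g M′)))
    (trans (sumTo-*r (suc N) (f M * g M′) _) (cong (_* (f M * g M′)) (δ-convolution (n ℕ.* M) (n ℕ.* M′) N)))
  -- terms with nM + nk > N vanish, so the inner range may be enlarged to k ≤ N
  reindex : ∀ M → M ≤ N → sumTo (suc N ∸ M) (λ k → δ (n ℕ.* (M ℕ.+ k)) N * (f M * g ((M ℕ.+ k) ∸ M)))
                        ≡ sumTo (suc N) (λ k → δ (n ℕ.* M ℕ.+ n ℕ.* k) N * (f M * g k))
  reindex M M≤N =
    trans (sumTo-ext (suc N ∸ M) (λ k → cong₂ (λ a b → δ a N * (f M * g b)) (ℕP.*-distribˡ-+ n M k) (ℕP.m+n∸m≡n M k)))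
      (sym (sumTo-extend (suc N ∸ M) (suc N) (ℕP.m∸n≤m (suc N) M) (λ k le _ →
        trans (cong (_* (f M * g k)) (δ-big (n ℕ.* M ℕ.+ n ℕ.* k) N (tooBig k le))) (0* (f M * g k)))))
    where
    tooBig : ∀ k → suc N ∸ M ≤ k → N < n ℕ.* M ℕ.+ n ℕ.* k
    tooBig k le = ℕP.<-≤-trans (ℕP.≤-trans (ℕP.≤-reflexive (sym (ℕP.m+[n∸m]≡n (ℕP.m≤n⇒m≤1+n M≤N))))
                                           (ℕP.+-monoʳ-≤ M le))
                               (ℕP.+-mono-≤ (ℕP.m≤n*m M n) (ℕP.m≤n*m k n))

-- The n-th term of an iterated sum: G(q^n) for n ≥ 1, and 0 for n = 0
-- (the summation indices of Z_Q are positive).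
substPow⁺ : ℕ → PS → PS
substPow⁺ zero    f = zeroP
substPow⁺ (suc n) f = substPow (suc n) f

substPow⁺-linear : ∀ n → IsLinear (substPow⁺ n)
substPow⁺-linear zero = record
  { ≈-cong = λ _ → ≈-refl ; +-hom = λ _ _ _ → sym (0+ 0ℚ) ; ·-hom = λ c _ _ → sym (*0 c) ; 0-hom = ≈-refl }
substPow⁺-linear (suc n) = substPow-linear (suc n)

substPow⁺-⊛ : ∀ n f g → substPow⁺ n (f ⊛ g) ≈ₚ (substPow⁺ n f ⊛ substPow⁺ n g)
substPow⁺-⊛ zero    f g = ≈-sym (⊛-zeroˡ zeroP)
substPow⁺-⊛ (suc n) f g = substPow-⊛ n f g

substPow⁺-low : ∀ n f i → f 0 ≡ 0ℚ → i < n → substPow⁺ n f i ≡ 0ℚ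
substPow⁺-low (suc n) f i f0 i<n = substPow-low (suc n) f i f0 i<n

-- Iterated sums.  For a word w = f_1 … f_l of series,
--   ZWord w m = Σ_{m > n_1 > … > n_l > 0} Π_j f_j(q^{n_j}).

outerSum : PS → (ℕ → PS) → ℕ → PS
outerSum f F m N = sumTo m (λ n → (substPow⁺ n f ⊛ F n) N)

ZWord : List PS → ℕ → PS
ZWord []      m = oneP
ZWord (f ∷ w)   = outerSum f (ZWord w)

letter : (ℕ → Poly) → ℕ → PS
letter Q s = polyP (Q s) ⊛ powP geomP s

ZLess-ZWord : ∀ Q l m → ZLess Q l m ≈ₚ ZWord (map (letter Q) l) m
ZLess-ZWord Q []      m = ≈-refl
ZLess-ZWord Q (s ∷ l) m N = sumTo-ext m term
  where
  term : ∀ n → _ ≡ (substPow⁺ n (letter Q s) ⊛ ZWord (map (letter Q) l) n) N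
  term zero    = sym (⊛-zeroˡ (ZWord (map (letter Q) l) 0) N)
  term (suc n) = ⊛-cong (≈-refl {substPow⁺ (suc n) (letter Q s)}) (ZLess-ZWord Q l (suc n)) N

-- If the letters vanish at 0, the outermost index n_1 ≥ 1 contributes only
-- from q^{n_1} on, so the coefficient of q^N needs only n_1 ≤ N.
ZWord-truncate : ∀ w → All (λ f → f 0 ≡ 0ℚ) w → ∀ N m → N < m → ZWord w m N ≡ ZWord w (suc N) N
ZWord-truncate []      _          N m _   = refl
ZWord-truncate (f ∷ w) (f0 ∷ _) N m N<m =
  trans (cong (λ z → ZWord (f ∷ w) z N) (sym (ℕP.m+[n∸m]≡n N<m))) (extend (m ∸ suc N))
  where
  step : ∀ m → N < m → ZWord (f ∷ w) (suc m) N ≡ ZWord (f ∷ w) m N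
  step m N<m = trans (cong (ZWord (f ∷ w) m N +_) (sumTo-zero (suc N) (λ i i<sN →
      trans (cong (_* ZWord w m (N ∸ i)) (substPow⁺-low m f i f0 (ℕP.≤-<-trans (ℕP.≤-pred i<sN) N<m)))
            (0* (ZWord w m (N ∸ i))))))
    (+0 (ZWord (f ∷ w) m N))
  extend : ∀ k → ZWord (f ∷ w) (suc N ℕ.+ k) N ≡ ZWord (f ∷ w) (suc N) N
  extend zero    rewrite ℕP.+-identityʳ N = refl
  extend (suc k) rewrite ℕP.+-suc N k = trans (step (suc N ℕ.+ k) (s≤s (ℕP.m≤m+n N k))) (extend k)

stuffle : List PS → List PS → List (List PS)
stuffle []      w       = w ∷ []
stuffle (f ∷ v) []      = (f ∷ v) ∷ []
stuffle (f ∷ v) (g ∷ w) =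
  map (f ∷_) (stuffle v (g ∷ w)) ++ map (g ∷_) (stuffle (f ∷ v) w) ++ map ((f ⊛ g) ∷_) (stuffle v w)

sumZWord : List (List PS) → ℕ → PS
sumZWord []       m = zeroP
sumZWord (u ∷ us) m = ZWord u m +ₚ sumZWord us m

sumZWord-++ : ∀ xs ys m → sumZWord (xs ++ ys) m ≈ₚ (sumZWord xs m +ₚ sumZWord ys m)
sumZWord-++ []       ys m N = sym (0+ _)
sumZWord-++ (x ∷ xs) ys m N =
  trans (cong (ZWord x m N +_) (sumZWord-++ xs ys m N)) (sym (QP.+-assoc (ZWord x m N) _ _))

sumZWord-prefix-0 : ∀ f us → sumZWord (map (f ∷_) us) 0 ≈ₚ zeroP
sumZWord-prefix-0 f []       = ≈-refl
sumZWord-prefix-0 f (u ∷ us) N = trans (0+ _) (sumZWord-prefix-0 f us N)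

sumZWord-prefix-suc : ∀ f us m → sumZWord (map (f ∷_) us) (suc m) ≈ₚ
                                 (sumZWord (map (f ∷_) us) m +ₚ (substPow⁺ m f ⊛ sumZWord us m))
sumZWord-prefix-suc f []       m N = sym (trans (cong (0ℚ +_) (⊛-zeroʳ (substPow⁺ m f) N)) (0+ 0ℚ))
sumZWord-prefix-suc f (u ∷ us) m N =
  trans (cong (λ z → (ZWord (f ∷ u) m N + (a ⊛ ZWord u m) N) + z) (sumZWord-prefix-suc f us m N))
    (trans (solve 4 (λ p q r s → (p :+ q) :+ (r :+ s) := (p :+ r) :+ (q :+ s)) refl
                    (ZWord (f ∷ u) m N) ((a ⊛ ZWord u m) N) (sumZWord (map (f ∷_) us) m N) ((a ⊛ sumZWord us m) N))
           (cong (sumZWord (map (f ∷_) (u ∷ us)) m N +_) (sym (⊛-distribˡ (ZWord u m) (sumZWord us m) a N))))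
  where a = substPow⁺ m f

sumZWord-stuffle-split : ∀ f v g w m → sumZWord (stuffle (f ∷ v) (g ∷ w)) m ≈ₚ
  (sumZWord (map (f ∷_) (stuffle v (g ∷ w))) m +ₚ
   (sumZWord (map (g ∷_) (stuffle (f ∷ v) w)) m +ₚ sumZWord (map ((f ⊛ g) ∷_) (stuffle v w)) m))
sumZWord-stuffle-split f v g w m =
  ≈-trans (sumZWord-++ (map (f ∷_) (stuffle v (g ∷ w))) _ m)
          (+ₚ-cong (≈-refl {sumZWord (map (f ∷_) (stuffle v (g ∷ w))) m}) (sumZWord-++ (map (g ∷_) (stuffle (f ∷ v) w)) _ m))

⊛-expand : ∀ X a X′ Y b Y′ →
  ((X +ₚ a ⊛ X′) ⊛ (Y +ₚ b ⊛ Y′)) ≈ₚ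
  (((X ⊛ Y) +ₚ (b ⊛ (X ⊛ Y′))) +ₚ ((a ⊛ (X′ ⊛ Y)) +ₚ ((a ⊛ b) ⊛ (X′ ⊛ Y′))))
⊛-expand X a X′ Y b Y′ = begin
  (X +ₚ a ⊛ X′) ⊛ (Y +ₚ b ⊛ Y′)
    ≈⟨ ⊛-distribʳ X (a ⊛ X′) (Y +ₚ b ⊛ Y′) ⟩
  (X ⊛ (Y +ₚ b ⊛ Y′)) +ₚ ((a ⊛ X′) ⊛ (Y +ₚ b ⊛ Y′))
    ≈⟨ +ₚ-cong (⊛-distribˡ Y (b ⊛ Y′) X) (⊛-distribˡ Y (b ⊛ Y′) (a ⊛ X′)) ⟩
  ((X ⊛ Y) +ₚ (X ⊛ (b ⊛ Y′))) +ₚ (((a ⊛ X′) ⊛ Y) +ₚ ((a ⊛ X′) ⊛ (b ⊛ Y′)))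
    ≈⟨ +ₚ-cong (+ₚ-cong (≈-refl {X ⊛ Y}) commuteB) (+ₚ-cong (⊛-assoc a X′ Y) (⊛-interchange a X′ b Y′)) ⟩
  ((X ⊛ Y) +ₚ (b ⊛ (X ⊛ Y′))) +ₚ ((a ⊛ (X′ ⊛ Y)) +ₚ ((a ⊛ b) ⊛ (X′ ⊛ Y′))) ∎
  where
  open ≈-Reasoning
  commuteB : (X ⊛ (b ⊛ Y′)) ≈ₚ (b ⊛ (X ⊛ Y′))
  commuteB = ≈-trans (≈-sym (⊛-assoc X b Y′)) (≈-trans (⊛-cong (⊛-comm X b) (≈-refl {Y′})) (⊛-assoc b X Y′))

-- The stuffle product formula  Z(v) Z(w) = Σ_{u ∈ v * w} Z(u),
-- proved by induction on the bound m by splitting off the largest index.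
ZWord-stuffle : ∀ m v w → (ZWord v m ⊛ ZWord w m) ≈ₚ sumZWord (stuffle v w) m
ZWord-stuffle m []      w  = ≈-trans (⊛-identityˡ (ZWord w m)) (λ N → sym (+0 _))
ZWord-stuffle m (f ∷ v) [] = ≈-trans (⊛-identityʳ (ZWord (f ∷ v) m)) (λ N → sym (+0 _))
ZWord-stuffle zero (f ∷ v) (g ∷ w) = begin
  ZWord (f ∷ v) 0 ⊛ ZWord (g ∷ w) 0
    ≈⟨ ⊛-zeroˡ (ZWord (g ∷ w) 0) ⟩
  zeroP
    ≈⟨ (λ N → sym (trans (cong₂ _+_ (sumZWord-prefix-0 f A N)
                            (cong₂ _+_ (sumZWord-prefix-0 g B N) (sumZWord-prefix-0 (f ⊛ g) C N)))
                          (trans (0+ _) (0+ 0ℚ)))) ⟩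
  sumZWord (map (f ∷_) A) 0 +ₚ (sumZWord (map (g ∷_) B) 0 +ₚ sumZWord (map ((f ⊛ g) ∷_) C) 0)
    ≈⟨ ≈-sym (sumZWord-stuffle-split f v g w 0) ⟩
  sumZWord (stuffle (f ∷ v) (g ∷ w)) 0 ∎
  where
  open ≈-Reasoning
  A = stuffle v (g ∷ w)
  B = stuffle (f ∷ v) w
  C = stuffle v w
ZWord-stuffle (suc m) (f ∷ v) (g ∷ w) = begin
  (ZWord (f ∷ v) m +ₚ a ⊛ ZWord v m) ⊛ (ZWord (g ∷ w) m +ₚ b ⊛ ZWord w m)
    ≈⟨ ⊛-expand (ZWord (f ∷ v) m) a (ZWord v m) (ZWord (g ∷ w) m) b (ZWord w m) ⟩
  ((ZWord (f ∷ v) m ⊛ ZWord (g ∷ w) m) +ₚ (b ⊛ (ZWord (f ∷ v) m ⊛ ZWord w m))) +ₚ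
  ((a ⊛ (ZWord v m ⊛ ZWord (g ∷ w) m)) +ₚ ((a ⊛ b) ⊛ (ZWord v m ⊛ ZWord w m)))
    ≈⟨ +ₚ-cong (+ₚ-cong (ZWord-stuffle m (f ∷ v) (g ∷ w)) (⊛-cong (≈-refl {b}) (ZWord-stuffle m (f ∷ v) w)))
               (+ₚ-cong (⊛-cong (≈-refl {a}) (ZWord-stuffle m v (g ∷ w))) (⊛-cong (≈-refl {a ⊛ b}) (ZWord-stuffle m v w))) ⟩
  (sumZWord (stuffle (f ∷ v) (g ∷ w)) m +ₚ (b ⊛ SB′)) +ₚ ((a ⊛ SA′) +ₚ ((a ⊛ b) ⊛ SC′))
    ≈⟨ +ₚ-cong (+ₚ-cong (sumZWord-stuffle-split f v g w m) (≈-refl {b ⊛ SB′}))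
               (≈-refl {(a ⊛ SA′) +ₚ ((a ⊛ b) ⊛ SC′)}) ⟩
  (SA +ₚ (SB +ₚ SC) +ₚ (b ⊛ SB′)) +ₚ ((a ⊛ SA′) +ₚ ((a ⊛ b) ⊛ SC′))
    ≈⟨ (λ N → solve 6 (λ p q r s t u → (p :+ (q :+ r) :+ s) :+ (t :+ u) := (p :+ t) :+ ((q :+ s) :+ (r :+ u))) refl
                  (SA N) (SB N) (SC N) ((b ⊛ SB′) N) ((a ⊛ SA′) N) (((a ⊛ b) ⊛ SC′) N)) ⟩
  (SA +ₚ (a ⊛ SA′)) +ₚ ((SB +ₚ (b ⊛ SB′)) +ₚ (SC +ₚ ((a ⊛ b) ⊛ SC′)))
    ≈⟨ +ₚ-cong (≈-sym (sumZWord-prefix-suc f A m))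
               (+ₚ-cong (≈-sym (sumZWord-prefix-suc g B m))
                        (≈-trans (+ₚ-cong (≈-refl {SC}) (⊛-cong (≈-sym (substPow⁺-⊛ m f g)) (≈-refl {SC′})))
                                 (≈-sym (sumZWord-prefix-suc (f ⊛ g) C m)))) ⟩
  sumZWord (map (f ∷_) A) (suc m) +ₚ (sumZWord (map (g ∷_) B) (suc m) +ₚ sumZWord (map ((f ⊛ g) ∷_) C) (suc m))
    ≈⟨ ≈-sym (sumZWord-stuffle-split f v g w (suc m)) ⟩
  sumZWord (stuffle (f ∷ v) (g ∷ w)) (suc m) ∎
  where
  open ≈-Reasoning
  A = stuffle v (g ∷ w)
  B = stuffle (f ∷ v) w
  C = stuffle v w
  a = substPow⁺ m f
  b = substPow⁺ m g
  SA = sumZWord (map (f ∷_) A) m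
  SB = sumZWord (map (g ∷_) B) m
  SC = sumZWord (map ((f ⊛ g) ∷_) C) m
  SA′ = sumZWord A m
  SB′ = sumZWord B m
  SC′ = sumZWord C m

lc : {I : Set} → (I → PS) → List (ℚ × I) → PS
lc g []             = zeroP
lc g ((c , i) ∷ cs) = c ·ₚ g i +ₚ lc g cs

Span : {I : Set} → (I → PS) → (I → Set) → PS → Set
Span {I} g P f = Σ (List (ℚ × I)) λ cs → All (λ ci → P (proj₂ ci)) cs × (f ≈ₚ lc g cs)

module _ {I : Set} where

  lc-++ : ∀ (g : I → PS) xs ys → lc g (xs ++ ys) ≈ₚ (lc g xs +ₚ lc g ys)
  lc-++ g []             ys N = sym (0+ _)
  lc-++ g ((c , i) ∷ xs) ys N =
    trans (cong (c * g i N +_) (lc-++ g xs ys N)) (sym (QP.+-assoc (c * g i N) (lc g xs N) (lc g ys N)))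

  scaleCoeffs : ℚ → List (ℚ × I) → List (ℚ × I)
  scaleCoeffs d = map (λ ci → (d * proj₁ ci , proj₂ ci))

  lc-scale : ∀ (g : I → PS) d cs → lc g (scaleCoeffs d cs) ≈ₚ (d ·ₚ lc g cs)
  lc-scale g d []             N = sym (*0 d)
  lc-scale g d ((c , i) ∷ cs) N = trans (cong ((d * c) * g i N +_) (lc-scale g d cs N))
    (solve 4 (λ d c x y → (d :* c) :* x :+ d :* y := d :* (c :* x :+ y)) refl d c (g i N) (lc g cs N))

  All-scaleCoeffs : ∀ {P : I → Set} d cs → All (P ∘ proj₂) cs → All (P ∘ proj₂) (scaleCoeffs d cs)
  All-scaleCoeffs d []       []       = []
  All-scaleCoeffs d (_ ∷ cs) (p ∷ ps) = p ∷ All-scaleCoeffs d cs ps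

  lc-cong : ∀ {g g′ : I → PS} cs → (∀ i → g i ≈ₚ g′ i) → lc g cs ≈ₚ lc g′ cs
  lc-cong []             e = ≈-refl
  lc-cong ((c , i) ∷ cs) e = +ₚ-cong (·ₚ-cong c (e i)) (lc-cong cs e)

  lc-cong-at : ∀ {g g′ : I → PS} cs N → (∀ i → g i N ≡ g′ i N) → lc g cs N ≡ lc g′ cs N
  lc-cong-at []             N e = refl
  lc-cong-at ((c , i) ∷ cs) N e = cong₂ _+_ (cong (c *_) (e i)) (lc-cong-at cs N e)

  lc-linear : ∀ {Φ} → IsLinear Φ → (g : I → PS) → ∀ cs → Φ (lc g cs) ≈ₚ lc (Φ ∘ g) cs
  lc-linear L g []             = IsLinear.0-hom L
  lc-linear L g ((c , i) ∷ cs) =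
    ≈-trans (IsLinear.+-hom L _ _) (+ₚ-cong (IsLinear.·-hom L c (g i)) (lc-linear L g cs))

span-trans : ∀ {I J : Set} {g : I → PS} {g′ : J → PS} {P : I → Set} {P′ : J → Set} {f} →
             Span g P f → (∀ i → P i → Span g′ P′ (g i)) → Span g′ P′ f
span-trans {g = g} {g′} {P} {P′} (cs , ps , e) h =
  let (ds , qs , e′) = expand cs ps in ds , qs , ≈-trans e e′
  where
  expand : ∀ cs → All (P ∘ proj₂) cs → Span g′ P′ (lc g cs)
  expand []             []       = [] , [] , ≈-refl
  expand ((c , i) ∷ cs) (p ∷ ps) with h i p | expand cs ps
  ... | ds , qs , e₁ | es , rs , e₂ =
    scaleCoeffs c ds ++ es , AllP.++⁺ (All-scaleCoeffs c ds qs) rs ,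
    ≈-trans (+ₚ-cong (≈-trans (·ₚ-cong c e₁) (≈-sym (lc-scale g′ c ds))) e₂) (≈-sym (lc-++ g′ (scaleCoeffs c ds) es))

module _ {I : Set} {g : I → PS} {P : I → Set} where

  span-≈ : ∀ {f f′} → f ≈ₚ f′ → Span g P f′ → Span g P f
  span-≈ e (cs , ps , e′) = cs , ps , ≈-trans e e′

  span-gen : ∀ i → P i → Span g P (g i)
  span-gen i p = (1ℚ , i) ∷ [] , p ∷ [] , λ N → sym (trans (+0 _) (QP.*-identityˡ _))

  span-zero : Span g P zeroP
  span-zero = [] , [] , ≈-refl

  span-+ : ∀ {f f′} → Span g P f → Span g P f′ → Span g P (f +ₚ f′)
  span-+ (cs , ps , e) (ds , qs , e′) =
    cs ++ ds , AllP.++⁺ ps qs , ≈-trans (+ₚ-cong e e′) (≈-sym (lc-++ g cs ds))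

  span-· : ∀ c {f} → Span g P f → Span g P (c ·ₚ f)
  span-· c (cs , ps , e) =
    scaleCoeffs c cs , All-scaleCoeffs c cs ps , ≈-trans (·ₚ-cong c e) (≈-sym (lc-scale g c cs))

  span-neg : ∀ {f} → Span g P f → Span g P (negP f)
  span-neg {f} s = span-≈ (λ N → trans (cong -_ (sym (QP.*-identityˡ (f N)))) (QP.neg-distribˡ-* 1ℚ (f N)))
                          (span-· (- 1ℚ) s)

span-⊛ : ∀ {I J K : Set} {g : I → PS} {h : J → PS} {k : K → PS} {P Q R} →
  (∀ i j → P i → Q j → Span k R (g i ⊛ h j)) →
  ∀ {x y} → Span g P x → Span h Q y → Span k R (x ⊛ y)
span-⊛ {g = g} {h} gen (cs , ps , ex) (ds , qs , ey) =
  span-≈ (≈-trans (⊛-cong ex ey) (lc-linear (⊛-linearˡ (lc h ds)) g cs))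
    (span-trans (cs , ps , ≈-refl) λ i pi →
       span-≈ (lc-linear (⊛-linearʳ (g i)) h ds) (span-trans (ds , qs , ≈-refl) λ j qj → gen i j pi qj))

outerSum-linear : ∀ F m → IsLinear (λ f → outerSum f F m)
outerSum-linear F m = record
  { ≈-cong = λ e N → sumTo-ext m (λ n → ⊛-cong (IsLinear.≈-cong (L n) e) (≈-refl {F n}) N)
  ; +-hom  = λ f g N → trans (sumTo-ext m (λ n →
      ≈-trans (⊛-cong (IsLinear.+-hom (L n) f g) (≈-refl {F n})) (⊛-distribʳ (substPow⁺ n f) (substPow⁺ n g) (F n)) N))
      (sumTo-+ m (λ n → (substPow⁺ n f ⊛ F n) N) (λ n → (substPow⁺ n g ⊛ F n) N))
  ; ·-hom  = λ c f N → trans (sumTo-ext m (λ n →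
      ≈-trans (⊛-cong (IsLinear.·-hom (L n) c f) (≈-refl {F n})) (⊛-scaleˡ c (substPow⁺ n f) (F n)) N))
      (sumTo-*l m c (λ n → (substPow⁺ n f ⊛ F n) N))
  ; 0-hom  = λ N → sumTo-zero m (λ n _ → ≈-trans (⊛-cong (IsLinear.0-hom (L n)) (≈-refl {F n})) (⊛-zeroˡ (F n)) N) }
  where L = substPow⁺-linear

outerSum-cong : ∀ f {F G : ℕ → PS} m → (∀ n → F n ≈ₚ G n) → outerSum f F m ≈ₚ outerSum f G m
outerSum-cong f m e N = sumTo-ext m (λ n → ⊛-cong (≈-refl {substPow⁺ n f}) (e n) N)

outerSum-lc : ∀ {I : Set} f (Z : I → ℕ → PS) cs m →
              outerSum f (λ n → lc (λ i → Z i n) cs) m ≈ₚ lc (λ i → outerSum f (Z i) m) cs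
outerSum-lc f Z []             m N = sumTo-zero m (λ n _ → ⊛-zeroʳ (substPow⁺ n f) N)
outerSum-lc f Z ((c , i) ∷ cs) m N =
  trans (sumTo-ext m (λ n → ≈-trans (⊛-distribˡ (c ·ₚ Z i n) (lc (λ i → Z i n) cs) (substPow⁺ n f))
                                    (+ₚ-cong (⊛-scaleʳ c (substPow⁺ n f) (Z i n)) ≈-refl) N))
  (trans (sumTo-+ m (λ n → c * (substPow⁺ n f ⊛ Z i n) N) (λ n → (substPow⁺ n f ⊛ lc (λ i → Z i n) cs) N))
         (cong₂ _+_ (sumTo-*l m c (λ n → (substPow⁺ n f ⊛ Z i n) N)) (outerSum-lc f Z cs m N)))

prependCoeffs : List (ℚ × ℕ) → List (ℚ × List ℕ) → List (ℚ × List ℕ)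
prependCoeffs []             cs = []
prependCoeffs ((d , k) ∷ ds) cs = map (λ cl → (d * proj₁ cl , k ∷ proj₂ cl)) cs ++ prependCoeffs ds cs

lc-prependCoeffs : ∀ (H : List ℕ → PS) ds cs →
                   lc (λ k → lc (λ l → H (k ∷ l)) cs) ds ≈ₚ lc H (prependCoeffs ds cs)
lc-prependCoeffs H []             cs = ≈-refl
lc-prependCoeffs H ((d , k) ∷ ds) cs =
  ≈-trans (+ₚ-cong (≈-sym (prependOne cs)) (lc-prependCoeffs H ds cs))
          (≈-sym (lc-++ H (map (λ cl → (d * proj₁ cl , k ∷ proj₂ cl)) cs) (prependCoeffs ds cs)))
  where
  prependOne : ∀ cs → lc H (map (λ cl → (d * proj₁ cl , k ∷ proj₂ cl)) cs) ≈ₚ (d ·ₚ lc (λ l → H (k ∷ l)) cs)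
  prependOne []             N = sym (*0 d)
  prependOne ((c , l) ∷ cs) N = trans (cong ((d * c) * H (k ∷ l) N +_) (prependOne cs N))
    (solve 4 (λ d c x y → (d :* c) :* x :+ d :* y := d :* (c :* x :+ y)) refl d c (H (k ∷ l) N) (lc (λ l → H (k ∷ l)) cs N))

All-prependCoeffs : ∀ {P : ℕ → Set} ds cs → All (P ∘ proj₂) ds → All (All P ∘ proj₂) cs →
                    All (All P ∘ proj₂) (prependCoeffs ds cs)
All-prependCoeffs []             cs []       qs = []
All-prependCoeffs ((d , k) ∷ ds) cs (p ∷ ps) qs = AllP.++⁺ (prependOne cs qs) (All-prependCoeffs ds cs ps qs)
  where
  prependOne : ∀ cs → All (All _ ∘ proj₂) cs → All (All _ ∘ proj₂) (map (λ cl → (d * proj₁ cl , k ∷ proj₂ cl)) cs)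
  prependOne []       []       = []
  prependOne (_ ∷ cs) (q ∷ qs) = (p ∷ q) ∷ prependOne cs qs

UniformSpan : (ℕ → PS) → (ℕ → Set) → (ℕ → PS) → Set
UniformSpan M P F = Σ (List (ℚ × List ℕ)) λ cs →
  All (All P ∘ proj₂) cs × (∀ m → F m ≈ₚ lc (λ l → ZWord (map M l) m) cs)

ZWord-multilinear : ∀ (M : ℕ → PS) (P : ℕ → Set) w → All (Span M P) w → UniformSpan M P (ZWord w)
ZWord-multilinear M P []      []  = (1ℚ , []) ∷ [] , [] ∷ [] , λ m N → sym (trans (+0 _) (QP.*-identityˡ _))
ZWord-multilinear M P (f ∷ w) ((ds , ps , ef) ∷ sw) with ZWord-multilinear M P w sw
... | cs , qs , ew = prependCoeffs ds cs , All-prependCoeffs ds cs ps qs , λ m → begin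
  outerSum f (ZWord w) m                      ≈⟨ outerSum-cong f m ew ⟩
  outerSum f inner m                          ≈⟨ IsLinear.≈-cong (outerSum-linear inner m) ef ⟩
  outerSum (lc M ds) inner m                  ≈⟨ lc-linear (outerSum-linear inner m) M ds ⟩
  lc (λ k → outerSum (M k) inner m) ds        ≈⟨ lc-cong ds (λ k → outerSum-lc (M k) (λ l → ZWord (map M l)) cs m) ⟩
  lc (λ k → lc (λ l → ZWord (map M (k ∷ l)) m) cs) ds ≈⟨ lc-prependCoeffs (λ l → ZWord (map M l) m) ds cs ⟩
  lc (λ l → ZWord (map M l) m) (prependCoeffs ds cs) ∎
  where
  open ≈-Reasoning
  inner : ℕ → PS
  inner n = lc (λ l → ZWord (map M l) n) cs

sumZWord-multilinear : ∀ (M : ℕ → PS) (P : ℕ → Set) us → All (All (Span M P)) us →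
                       UniformSpan M P (sumZWord us)
sumZWord-multilinear M P []       []       = [] , [] , λ m → ≈-refl
sumZWord-multilinear M P (u ∷ us) (a ∷ as) with ZWord-multilinear M P u a | sumZWord-multilinear M P us as
... | cs , ps , e | ds , qs , e′ =
  cs ++ ds , AllP.++⁺ ps qs , λ m → ≈-trans (+ₚ-cong (e m) (e′ m)) (≈-sym (lc-++ _ cs ds))

All-stuffle : ∀ (S : PS → Set) → (∀ a b → S a → S b → S (a ⊛ b)) →
              ∀ v w → All S v → All S w → All (All S) (stuffle v w)
All-stuffle S closed []      w       av aw = aw ∷ []
All-stuffle S closed (f ∷ v) []      av aw = av ∷ []
All-stuffle S closed (f ∷ v) (g ∷ w) (af ∷ av) (ag ∷ aw) =
  AllP.++⁺ (AllP.map⁺ (All.map (af ∷_) (All-stuffle S closed v (g ∷ w) av (ag ∷ aw))))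
   (AllP.++⁺ (AllP.map⁺ (All.map (ag ∷_) (All-stuffle S closed (f ∷ v) w (af ∷ av) aw)))
             (AllP.map⁺ (All.map (closed f g af ag ∷_) (All-stuffle S closed v w av aw))))

tSeries : PS
tSeries (suc zero) = 1ℚ
tSeries _          = 0ℚ

tpow : ℕ → PS
tpow = powP tSeries

gpow : ℕ → PS
gpow = powP geomP

C : ℕ → PS
C k = tSeries ⊛ gpow k

t⊛-zero : ∀ h → (tSeries ⊛ h) 0 ≡ 0ℚ
t⊛-zero h = trans (0+ _) (0* (h 0))

t⊛-suc : ∀ h N → (tSeries ⊛ h) (suc N) ≡ h N
t⊛-suc h N = trans (sumTo-single (suc (suc N)) 1 (s≤s (s≤s z≤n)) others) (QP.*-identityˡ (h N))
  where
  others : ∀ i → i < suc (suc N) → i ≢ 1 → tSeries i * h (suc N ∸ i) ≡ 0ℚ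
  others zero          _ _  = 0* (h (suc N))
  others (suc zero)    _ ne = ⊥-elim (ne refl)
  others (suc (suc i)) _ _  = 0* (h (suc N ∸ suc (suc i)))

C-zero : ∀ k → C k 0 ≡ 0ℚ
C-zero k = t⊛-zero (gpow k)

t⊛geom : (tSeries ⊛ geomP) ≈ₚ (geomP -ₚ oneP)
t⊛geom zero    = trans (t⊛-zero geomP) (sym (QP.+-inverseʳ 1ℚ))
t⊛geom (suc N) = trans (t⊛-suc geomP N) (sym (+0 1ℚ))

t⊛gpow : ∀ K → (tSeries ⊛ gpow (suc K)) ≈ₚ (gpow (suc K) -ₚ gpow K)
t⊛gpow K = begin
  tSeries ⊛ (geomP ⊛ gpow K)                ≈⟨ ≈-sym (⊛-assoc tSeries geomP (gpow K)) ⟩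
  (tSeries ⊛ geomP) ⊛ gpow K                ≈⟨ ⊛-cong t⊛geom (≈-refl {gpow K}) ⟩
  (geomP -ₚ oneP) ⊛ gpow K                  ≈⟨ ⊛-distribʳ geomP (negP oneP) (gpow K) ⟩
  (geomP ⊛ gpow K) +ₚ (negP oneP ⊛ gpow K)  ≈⟨ +ₚ-cong (≈-refl {gpow (suc K)})
                                                       (≈-trans (⊛-negˡ oneP (gpow K)) (λ N → cong -_ (⊛-identityˡ (gpow K) N))) ⟩
  gpow (suc K) -ₚ gpow K                    ∎
  where open ≈-Reasoning

gpow-+ : ∀ a b → (gpow a ⊛ gpow b) ≈ₚ gpow (a ℕ.+ b)
gpow-+ zero    b = ⊛-identityˡ (gpow b)
gpow-+ (suc a) b = ≈-trans (⊛-assoc geomP (gpow a) (gpow b)) (⊛-cong (≈-refl {geomP}) (gpow-+ a b))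

C-product : ∀ a b K → a ℕ.+ b ≡ suc K → (C a ⊛ C b) ≈ₚ (C (suc K) -ₚ C K)
C-product a b K eq = begin
  (tSeries ⊛ gpow a) ⊛ (tSeries ⊛ gpow b)  ≈⟨ ⊛-interchange tSeries (gpow a) tSeries (gpow b) ⟩
  (tSeries ⊛ tSeries) ⊛ (gpow a ⊛ gpow b)  ≈⟨ ⊛-cong (≈-refl {tSeries ⊛ tSeries})
                                                      (≈-trans (gpow-+ a b) (λ N → cong (λ z → gpow z N) eq)) ⟩
  (tSeries ⊛ tSeries) ⊛ gpow (suc K)       ≈⟨ ⊛-assoc tSeries tSeries (gpow (suc K)) ⟩
  tSeries ⊛ (tSeries ⊛ gpow (suc K))       ≈⟨ ⊛-cong (≈-refl {tSeries}) (t⊛gpow K) ⟩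
  tSeries ⊛ (gpow (suc K) -ₚ gpow K)       ≈⟨ ⊛-distribˡ (gpow (suc K)) (negP (gpow K)) tSeries ⟩
  C (suc K) +ₚ (tSeries ⊛ negP (gpow K))   ≈⟨ +ₚ-cong (≈-refl {C (suc K)}) (⊛-negʳ tSeries (gpow K)) ⟩
  C (suc K) -ₚ C K                         ∎
  where open ≈-Reasoning

Ge2 : ℕ → Set
Ge2 k = 2 ≤ k

CSpan : PS → Set
CSpan = Span C Ge2

CSpan-⊛ : ∀ {x y} → CSpan x → CSpan y → CSpan (x ⊛ y)
CSpan-⊛ = span-⊛ C-product-span
  where
  C-product-span : ∀ a b → Ge2 a → Ge2 b → CSpan (C a ⊛ C b)
  C-product-span (suc (suc a)) (suc (suc b)) (s≤s (s≤s z≤n)) (s≤s (s≤s z≤n)) =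
    span-≈ (C-product (suc (suc a)) (suc (suc b)) K refl)
           (span-+ (span-gen (suc K) (s≤s (s≤s z≤n))) (span-neg (span-gen K 2≤K)))
    where
    K = suc (a ℕ.+ suc (suc b))
    2≤K : 2 ≤ K
    2≤K = s≤s (ℕP.≤-trans (s≤s z≤n) (ℕP.m≤n+m (suc (suc b)) a))

Span≤ : ℕ → PS → Set
Span≤ s = Span C (λ k → 2 ≤ k × k ≤ s)

span≤-mono : ∀ {a b f} → a ≤ b → Span≤ a f → Span≤ b f
span≤-mono a≤b sp = span-trans sp (λ k (2≤k , k≤a) → span-gen k (2≤k , ℕP.≤-trans k≤a a≤b))

span≤⇒CSpan : ∀ {s f} → Span≤ s f → CSpan f
span≤⇒CSpan sp = span-trans sp (λ k (2≤k , _) → span-gen k 2≤k)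

record LeadingC (s : ℕ) (c : ℚ) (f : PS) : Set where
  constructor leading
  field
    lower         : PS
    lower∈Span≤   : Span≤ (s ∸ 1) lower
    decomposition : f ≈ₚ (c ·ₚ C s +ₚ lower)

leadingC-≈ : ∀ {s c f g} → f ≈ₚ g → LeadingC s c g → LeadingC s c f
leadingC-≈ e (leading X spX eX) = leading X spX (≈-trans e eX)

leadingC-+ : ∀ {s c d f g} → LeadingC s c f → LeadingC s d g → LeadingC s (c + d) (f +ₚ g)
leadingC-+ {s} {c} {d} (leading X spX eX) (leading Y spY eY) = leading (X +ₚ Y) (span-+ spX spY) λ N →
  trans (cong₂ _+_ (eX N) (eY N))
        (solve 5 (λ c d k x y → (c :* k :+ x) :+ (d :* k :+ y) := (c :+ d) :* k :+ (x :+ y)) refl c d (C s N) (X N) (Y N))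

leadingC-· : ∀ {s c f} d → LeadingC s c f → LeadingC s (d * c) (d ·ₚ f)
leadingC-· {s} {c} d (leading X spX eX) = leading (d ·ₚ X) (span-· d spX) λ N →
  trans (cong (d *_) (eX N))
        (solve 4 (λ d c k x → d :* (c :* k :+ x) := (d :* c) :* k :+ d :* x) refl d c (C s N) (X N))

monomial-leadingC : ∀ j s → 1 ≤ j → j < s → LeadingC s 1ℚ (tpow j ⊛ gpow s)
monomial-leadingC (suc zero) s _ _ = leading zeroP span-zero λ N →
  trans (⊛-cong (⊛-identityʳ tSeries) (≈-refl {gpow s}) N)
        (sym (trans (+0 _) (QP.*-identityˡ (C s N))))
monomial-leadingC (suc (suc j)) (suc s) _ (s≤s j<s)
  with monomial-leadingC (suc j) (suc s) (s≤s z≤n) (ℕP.m<n⇒m<1+n j<s)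
     | monomial-leadingC (suc j) s (s≤s z≤n) j<s
... | leading X₁ sp₁ e₁ | leading X′ sp′ e′ =
  leading (X₁ +ₚ negP (1ℚ ·ₚ C s +ₚ X′))
  (span-+ sp₁ (span-neg (span-+ (span-· 1ℚ (span-gen s (ℕP.≤-trans (s≤s (s≤s z≤n)) j<s , ℕP.≤-refl)))
                               (span≤-mono (ℕP.m∸n≤m s 1) sp′))))
  (begin
    (tSeries ⊛ tj) ⊛ gpow (suc s)   ≈⟨ ⊛-cong (⊛-comm tSeries tj) (≈-refl {gpow (suc s)}) ⟩
    (tj ⊛ tSeries) ⊛ gpow (suc s)   ≈⟨ ⊛-assoc tj tSeries (gpow (suc s)) ⟩
    tj ⊛ (tSeries ⊛ gpow (suc s))   ≈⟨ ⊛-cong (≈-refl {tj}) (t⊛gpow s) ⟩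
    tj ⊛ (gpow (suc s) -ₚ gpow s)   ≈⟨ ⊛-distribˡ (gpow (suc s)) (negP (gpow s)) tj ⟩
    (tj ⊛ gpow (suc s)) +ₚ (tj ⊛ negP (gpow s))
                                    ≈⟨ +ₚ-cong e₁ (≈-trans (⊛-negʳ tj (gpow s)) (λ N → cong -_ (e′ N))) ⟩
    (1ℚ ·ₚ C (suc s) +ₚ X₁) +ₚ negP (1ℚ ·ₚ C s +ₚ X′)
                                    ≈⟨ (λ N → QP.+-assoc (1ℚ * C (suc s) N) (X₁ N) _) ⟩
    1ℚ ·ₚ C (suc s) +ₚ (X₁ +ₚ negP (1ℚ ·ₚ C s +ₚ X′)) ∎)
  where
  open ≈-Reasoning
  tj = tpow (suc j)

scaledMonomial-leadingC : ∀ c j s → 1 ≤ j → (s ≤ j → c ≡ 0ℚ) → LeadingC s c (c ·ₚ (tpow j ⊛ gpow s))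
scaledMonomial-leadingC c j s 1≤j high with j ℕ.<? s
... | yes j<s = subst (λ d → LeadingC s d (c ·ₚ (tpow j ⊛ gpow s))) (QP.*-identityʳ c)
                      (leadingC-· c (monomial-leadingC j s 1≤j j<s))
... | no j≮s rewrite high (ℕP.≮⇒≥ j≮s) =
  leading zeroP span-zero λ N → trans (0* ((tpow j ⊛ gpow s) N)) (sym (trans (+0 _) (0* (C s N))))

coeff-∷ : ∀ c r → coeff (c ∷ r) ≈ₚ (c ·ₚ oneP +ₚ tSeries ⊛ coeff r)
coeff-∷ c r zero    = sym (trans (cong₂ _+_ (QP.*-identityʳ c) (t⊛-zero (coeff r))) (+0 c))
coeff-∷ c r (suc N) = sym (trans (cong₂ _+_ (*0 c) (t⊛-suc (coeff r) N)) (0+ _))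

shiftedPoly-leadingC : ∀ r j s → 1 ≤ j → (∀ i → s ≤ j ℕ.+ i → coeff r i ≡ 0ℚ) →
                       LeadingC s (evalAt1 r) ((tpow j ⊛ coeff r) ⊛ gpow s)
shiftedPoly-leadingC [] j s _ _ = leading zeroP span-zero λ N →
  trans (≈-trans (⊛-cong (⊛-zeroʳ (tpow j)) (≈-refl {gpow s})) (⊛-zeroˡ (gpow s)) N)
        (sym (trans (+0 _) (0* (C s N))))
shiftedPoly-leadingC (c ∷ r) j s 1≤j deg =
  leadingC-≈ split (leadingC-+ (scaledMonomial-leadingC c j s 1≤j constantTerm) rest)
  where
  constantTerm : s ≤ j → c ≡ 0ℚ
  constantTerm s≤j = deg 0 (ℕP.≤-trans s≤j (ℕP.≤-reflexive (sym (ℕP.+-identityʳ j))))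
  rest : LeadingC s (evalAt1 r) ((tpow (suc j) ⊛ coeff r) ⊛ gpow s)
  rest = shiftedPoly-leadingC r (suc j) s (s≤s z≤n)
           (λ i le → deg (suc i) (ℕP.≤-trans le (ℕP.≤-reflexive (sym (ℕP.+-suc j i)))))
  split : ((tpow j ⊛ coeff (c ∷ r)) ⊛ gpow s) ≈ₚ ((c ·ₚ (tpow j ⊛ gpow s)) +ₚ ((tpow (suc j) ⊛ coeff r) ⊛ gpow s))
  split = begin
    (tpow j ⊛ coeff (c ∷ r)) ⊛ gpow s
      ≈⟨ ⊛-cong (⊛-cong (≈-refl {tpow j}) (coeff-∷ c r)) (≈-refl {gpow s}) ⟩
    (tpow j ⊛ (c ·ₚ oneP +ₚ tSeries ⊛ coeff r)) ⊛ gpow s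
      ≈⟨ ⊛-cong (⊛-distribˡ (c ·ₚ oneP) (tSeries ⊛ coeff r) (tpow j)) (≈-refl {gpow s}) ⟩
    ((tpow j ⊛ (c ·ₚ oneP)) +ₚ (tpow j ⊛ (tSeries ⊛ coeff r))) ⊛ gpow s
      ≈⟨ ⊛-distribʳ (tpow j ⊛ (c ·ₚ oneP)) (tpow j ⊛ (tSeries ⊛ coeff r)) (gpow s) ⟩
    ((tpow j ⊛ (c ·ₚ oneP)) ⊛ gpow s) +ₚ ((tpow j ⊛ (tSeries ⊛ coeff r)) ⊛ gpow s)
      ≈⟨ +ₚ-cong (⊛-cong (≈-trans (⊛-scaleʳ c (tpow j) oneP) (·ₚ-cong c (⊛-identityʳ (tpow j)))) (≈-refl {gpow s}))
                 (⊛-cong (≈-trans (≈-sym (⊛-assoc (tpow j) tSeries (coeff r)))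
                                  (⊛-cong (⊛-comm (tpow j) tSeries) (≈-refl {coeff r}))) (≈-refl {gpow s})) ⟩
    ((c ·ₚ tpow j) ⊛ gpow s) +ₚ ((tpow (suc j) ⊛ coeff r) ⊛ gpow s)
      ≈⟨ +ₚ-cong (⊛-scaleˡ c (tpow j) (gpow s)) (≈-refl {(tpow (suc j) ⊛ coeff r) ⊛ gpow s}) ⟩
    (c ·ₚ (tpow j ⊛ gpow s)) +ₚ ((tpow (suc j) ⊛ coeff r) ⊛ gpow s) ∎
    where open ≈-Reasoning

poly-leadingC : ∀ p s → coeff p 0 ≡ 0ℚ → (∀ k → s ≤ k → coeff p k ≡ 0ℚ) →
                LeadingC s (evalAt1 p) (coeff p ⊛ gpow s)
poly-leadingC []      s _  _   = leading zeroP span-zero λ N →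
  trans (⊛-zeroˡ (gpow s) N) (sym (trans (+0 _) (0* (C s N))))
poly-leadingC (c ∷ r) s c≡0 deg rewrite c≡0 =
  subst (λ d → LeadingC s d (coeff (0ℚ ∷ r) ⊛ gpow s)) (sym (0+ (evalAt1 r)))
        (leadingC-≈ (⊛-cong dropConstant (≈-refl {gpow s})) (shiftedPoly-leadingC r 1 s ℕP.≤-refl (λ i → deg (suc i))))
  where
  dropConstant : coeff (0ℚ ∷ r) ≈ₚ (tpow 1 ⊛ coeff r)
  dropConstant N = trans (coeff-∷ 0ℚ r N)
    (trans (cong (_+ (tSeries ⊛ coeff r) N) (0* (oneP N)))
           (trans (0+ _) (sym (⊛-cong (⊛-identityʳ tSeries) (≈-refl {coeff r}) N))))

record Admissible (Q : ℕ → Poly) : Set where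
  field
    vanishesAt0 : ∀ s → 2 ≤ s → coeff (Q s) 0 ≡ 0ℚ
    nonzeroAt1  : ∀ s → 2 ≤ s → evalAt1 (Q s) ≢ 0ℚ
    degree<     : ∀ s → 2 ≤ s → ∀ k → s ≤ k → coeff (Q s) k ≡ 0ℚ

module _ {Q : ℕ → Poly} (adm : Admissible Q) where
  open Admissible adm

  letter-leadingC : ∀ s → 2 ≤ s → LeadingC s (evalAt1 (Q s)) (letter Q s)
  letter-leadingC s 2≤s = poly-leadingC (Q s) s (vanishesAt0 s 2≤s) (degree< s 2≤s)

  letter∈CSpan : ∀ s → 2 ≤ s → CSpan (letter Q s)
  letter∈CSpan s 2≤s with letter-leadingC s 2≤s
  ... | leading X sp e = span-≈ e (span-+ (span-· (evalAt1 (Q s)) (span-gen s 2≤s)) (span≤⇒CSpan sp))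

  -- inverting the triangular change of basis, by induction on s:
  -- C_s = Q_s(1)⁻¹ (L_s - lower terms)
  C∈letterSpan : ∀ s → 2 ≤ s → Span (letter Q) Ge2 (C s)
  C∈letterSpan s = invert s s ℕP.≤-refl
    where
    invert : ∀ b s → s ≤ b → 2 ≤ s → Span (letter Q) Ge2 (C s)
    invert zero    s s≤0   2≤s = ⊥-elim (ℕP.<-irrefl refl (ℕP.≤-trans 2≤s (ℕP.≤-trans s≤0 z≤n)))
    invert (suc b) s s≤sb 2≤s with letter-leadingC s 2≤s
    ... | leading X sp e = span-≈ solveForC (span-· (1/ v) (span-+ (span-gen s 2≤s) (span-neg lower)))
      where
      v = evalAt1 (Q s)
      instance
        v≢0 : NonZero v
        v≢0 = ≢-nonZero (nonzeroAt1 s 2≤s)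
      lower : Span (letter Q) Ge2 X
      lower = span-trans sp (λ k (2≤k , k≤s-1) → invert b k (ℕP.≤-trans k≤s-1 (ℕP.∸-monoˡ-≤ 1 s≤sb)) 2≤k)
      solveForC : C s ≈ₚ ((1/ v) ·ₚ (letter Q s +ₚ negP X))
      solveForC N = sym (trans (cong (λ z → (1/ v) * (z + - X N)) (e N))
        (trans (solve 4 (λ i a c x → i :* ((a :* c :+ x) :+ (:- x)) := (i :* a) :* c) refl (1/ v) v (C s N) (X N))
               (trans (cong (_* C s N) (QP.*-inverseˡ v)) (QP.*-identityˡ (C s N)))))

ZLetters : (ℕ → PS) → List ℕ → PS
ZLetters L l N = ZWord (map L l) (suc N) N

linComb-ZQ : ∀ Q cs N → linComb (ZQ Q) cs N ≡ lc (ZLetters (letter Q)) cs N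
linComb-ZQ Q []             N = refl
linComb-ZQ Q ((c , l) ∷ cs) N = cong₂ _+_ (cong (c *_) (ZLess-ZWord Q l (suc N) N)) (linComb-ZQ Q cs N)

ZSpan⇒span : ∀ {Q f} → ZSpan Q f → Span (ZLetters (letter Q)) AllGe2 f
ZSpan⇒span {Q} (cs , ps , e) = cs , ps , λ N → trans (e N) (linComb-ZQ Q cs N)

span⇒ZSpan : ∀ {Q f} → Span (ZLetters (letter Q)) AllGe2 f → ZSpan Q f
span⇒ZSpan {Q} (cs , ps , e) = cs , ps , λ N → trans (e N) (sym (linComb-ZQ Q cs N))

changeLetters : ∀ {L M : ℕ → PS} {P P′ : ℕ → Set} {f} →
                (∀ s → P s → Span M P′ (L s)) → Span (ZLetters L) (All P) f → Span (ZLetters M) (All P′) f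
changeLetters {L} {M} {P} {P′} L∈M sp = span-trans sp word
  where
  word : ∀ l → All P l → Span (ZLetters M) (All P′) (ZLetters L l)
  word l al with ZWord-multilinear M P′ (map L l) (AllP.map⁺ (All.map (λ {s} → L∈M s) al))
  ... | cs , qs , e = cs , qs , λ N → trans (e (suc N) N) (lc-cong-at cs N (λ _ → refl))

ZCSpan : PS → Set
ZCSpan = Span (ZLetters C) AllGe2

-- 𝓒 is closed under products: stuffle, and products of C's stay in the C-span
ZCSpan-⊛ : ∀ {f g} → ZCSpan f → ZCSpan g → ZCSpan (f ⊛ g)
ZCSpan-⊛ = span-⊛ product
  where
  vanishAt0 : ∀ l → All (λ f → f 0 ≡ 0ℚ) (map C l)
  vanishAt0 []      = []
  vanishAt0 (k ∷ l) = C-zero k ∷ vanishAt0 l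
  inCSpan : ∀ l → AllGe2 l → All CSpan (map C l)
  inCSpan []      []       = []
  inCSpan (k ∷ l) (p ∷ ps) = span-gen k p ∷ inCSpan l ps
  product : ∀ l l′ → AllGe2 l → AllGe2 l′ → ZCSpan (ZLetters C l ⊛ ZLetters C l′)
  product l l′ al al′
    with sumZWord-multilinear C Ge2 (stuffle (map C l) (map C l′))
           (All-stuffle CSpan (λ _ _ → CSpan-⊛) (map C l) (map C l′) (inCSpan l al) (inCSpan l′ al′))
  ... | cs , qs , e = cs , qs , λ N → begin
    (ZLetters C l ⊛ ZLetters C l′) N
      ≡⟨ ⊛-bounded N (λ i i≤N → sym (ZWord-truncate (map C l) (vanishAt0 l) i (suc N) (s≤s i≤N)))
                     (λ i i≤N → sym (ZWord-truncate (map C l′) (vanishAt0 l′) i (suc N) (s≤s i≤N))) ⟩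
    (ZWord (map C l) (suc N) ⊛ ZWord (map C l′) (suc N)) N
      ≡⟨ ZWord-stuffle (suc N) (map C l) (map C l′) N ⟩
    sumZWord (stuffle (map C l) (map C l′)) (suc N) N
      ≡⟨ e (suc N) N ⟩
    lc (λ w → ZWord (map C w) (suc N)) cs N
      ≡⟨ lc-cong-at cs N (λ _ → refl) ⟩
    lc (ZLetters C) cs N ∎
    where open ≡-Reasoning

module _ {Q : ℕ → Poly} (adm : Admissible Q) where

  ZSpan⇒ZCSpan : ∀ {f} → ZSpan Q f → ZCSpan f
  ZSpan⇒ZCSpan z = changeLetters (letter∈CSpan adm) (ZSpan⇒span z)

  ZCSpan⇒ZSpan : ∀ {f} → ZCSpan f → ZSpan Q f
  ZCSpan⇒ZSpan z = span⇒ZSpan (changeLetters (C∈letterSpan adm) z)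

  ZSpan-⊛ : ∀ f g → ZSpan Q f → ZSpan Q g → ZSpan Q (f ⊛ g)
  ZSpan-⊛ f g zf zg = ZCSpan⇒ZSpan (ZCSpan-⊛ (ZSpan⇒ZCSpan zf) (ZSpan⇒ZCSpan zg))

ZSpan-one : ∀ Q → ZSpan Q oneP
ZSpan-one Q = (1ℚ , []) ∷ [] , [] ∷ [] , λ N → sym (trans (+0 _) (QP.*-identityˡ (oneP N)))

MDsharp⇒MD : ∀ f → MDsharp f → MD f
MDsharp⇒MD f (cs , ps , e) = cs , All.map (All.map (ℕP.≤-trans (s≤s z≤n))) ps , e

-- The key input is that t P_{s-1}(t) = (1-t)^s Σ_d d^{s-1} t^d
-- has vanishing constant term, vanishing coefficient of t^s, and value
-- (s-1)! at t = 1.  These come from the calculus of finite differences: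
-- the coefficient of t^{m+r} of (1-t)^r a(t) is Δ^r a(m), and d ↦ d^k has
-- constant k-th difference k!.

ι : ℕ → ℚ
ι n = (ℤ.+ n) / 1

ι-suc : ∀ n → ι (suc n) ≡ ι n + 1ℚ
ι-suc n = sym (QP.toℚᵘ-injective (UP.≃-trans (QP.toℚᵘ-homo-+ (ι n) 1ℚ)
  (subst (λ z → (toℚᵘ z U.+ toℚᵘ 1ℚ) U.≃ toℚᵘ (ι (suc n))) (sym (asMkℚ n))
  (subst (λ z → (U.mkℚᵘ (ℤ.+ n) 0 U.+ U.mkℚᵘ (ℤ.+ 1) 0) U.≃ toℚᵘ z) (sym (asMkℚ (suc n))) (U.*≡* cross)))))
  where
  open ℤSolver.+-*-Solver using () renaming (solve to ℤsolve; _:*_ to _ℤ*_; _:+_ to _ℤ+_; _:=_ to _ℤ=_; con to ℤcon)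
  asMkℚ : ∀ n → ι n ≡ mkℚ (ℤ.+ n) 0 (Coprimality.sym (Coprimality.1-coprimeTo n))
  asMkℚ n = QP.normalize-coprime (Coprimality.sym (Coprimality.1-coprimeTo n))
  cross : ((ℤ.+ n) ℤ.* (ℤ.+ 1) ℤ.+ (ℤ.+ 1) ℤ.* (ℤ.+ 1)) ℤ.* (ℤ.+ 1) ≡ (ℤ.+ suc n) ℤ.* (ℤ.+ 1)
  cross = trans (ℤsolve 1 (λ x → (x ℤ* ℤcon (ℤ.+ 1) ℤ+ ℤcon (ℤ.+ 1) ℤ* ℤcon (ℤ.+ 1)) ℤ* ℤcon (ℤ.+ 1)
                              ℤ= (x ℤ+ ℤcon (ℤ.+ 1)) ℤ* ℤcon (ℤ.+ 1)) refl (ℤ.+ n))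
                (cong (λ z → (ℤ.+ z) ℤ.* (ℤ.+ 1)) (ℕP.+-comm n 1))

ι-+ : ∀ m n → ι (m ℕ.+ n) ≡ ι m + ι n
ι-+ zero    n = sym (0+ (ι n))
ι-+ (suc m) n = trans (ι-suc (m ℕ.+ n)) (trans (cong (_+ 1ℚ) (ι-+ m n))
  (trans (solve 3 (λ a b o → (a :+ b) :+ o := (a :+ o) :+ b) refl (ι m) (ι n) 1ℚ) (cong (_+ ι n) (sym (ι-suc m)))))

ι-* : ∀ m n → ι (m ℕ.* n) ≡ ι m * ι n
ι-* zero    n = sym (0* (ι n))
ι-* (suc m) n = trans (ι-+ n (m ℕ.* n)) (trans (cong (ι n +_) (ι-* m n))
  (trans (solve 2 (λ a b → b :+ a :* b := (a :+ con 1ℚ) :* b) refl (ι m) (ι n)) (cong (_* ι n) (sym (ι-suc m)))))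

ι-pos : ∀ n → Positive (ι (suc n))
ι-pos n = QP.normalize-pos (suc n) 1

pos⇒≢0 : ∀ p → .{{Positive p}} → p ≢ 0ℚ
pos⇒≢0 p p≡0 = QP.<-irrefl refl (subst (0ℚ <ℚ_) p≡0 (QP.positive⁻¹ p))

Δ : (ℕ → ℚ) → ℕ → ℚ
Δ b m = b (suc m) - b m

iterΔ : ℕ → (ℕ → ℚ) → ℕ → ℚ
iterΔ zero    a = a
iterΔ (suc r) a = Δ (iterΔ r a)

iterΔ-suc : ∀ r a x → iterΔ (suc r) a x ≡ iterΔ r (Δ a) x
iterΔ-suc zero    a x = refl
iterΔ-suc (suc r) a x = cong₂ _-_ (iterΔ-suc r a (suc x)) (iterΔ-suc r a x)

-- c · d!, computed as c · d · (d-1) ⋯ 1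
c·! : ℕ → ℚ → ℚ
c·! zero    c = c
c·! (suc d) c = c·! d (c * ι (suc d))

-- PolyFn d c p: p is a polynomial function of degree ≤ d with coefficient c
-- at x^d, characterised inductively: Δp is of degree ≤ d-1 with coefficient d·c
PolyFn : ℕ → ℚ → (ℕ → ℚ) → Set
PolyFn zero    c p = ∀ x → p x ≡ c
PolyFn (suc d) c p = PolyFn d (c * ι (suc d)) (Δ p)

PolyFn-iterΔ : ∀ d c p → PolyFn d c p → ∀ x → iterΔ d p x ≡ c·! d c
PolyFn-iterΔ zero    c p h x = h x
PolyFn-iterΔ (suc d) c p h x = trans (iterΔ-suc d p x) (PolyFn-iterΔ d _ (Δ p) h x)

PolyFn-iterΔ-suc : ∀ d c p → PolyFn d c p → ∀ x → iterΔ (suc d) p x ≡ 0ℚ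
PolyFn-iterΔ-suc d c p h x =
  trans (cong₂ _-_ (PolyFn-iterΔ d c p h (suc x)) (PolyFn-iterΔ d c p h x)) (QP.+-inverseʳ (c·! d c))

PolyFn-cong : ∀ d c {p q} → (∀ x → p x ≡ q x) → PolyFn d c p → PolyFn d c q
PolyFn-cong zero    c e h x = trans (sym (e x)) (h x)
PolyFn-cong (suc d) c e h = PolyFn-cong d _ (λ x → cong₂ _-_ (e (suc x)) (e x)) h

PolyFn-+ : ∀ d c c′ p p′ → PolyFn d c p → PolyFn d c′ p′ → PolyFn d (c + c′) (λ x → p x + p′ x)
PolyFn-+ zero    c c′ p p′ h h′ x = cong₂ _+_ (h x) (h′ x)
PolyFn-+ (suc d) c c′ p p′ h h′ =
  subst (λ k → PolyFn d k (Δ (λ x → p x + p′ x))) (sym (QP.*-distribʳ-+ (ι (suc d)) c c′))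
    (PolyFn-cong d _ (λ x → sym (solve 4 (λ a b a′ b′ → (a :+ b) :+ (:- (a′ :+ b′)) := (a :+ (:- a′)) :+ (b :+ (:- b′))) refl
                                    (p (suc x)) (p′ (suc x)) (p x) (p′ x)))
      (PolyFn-+ d _ _ (Δ p) (Δ p′) h h′))

PolyFn-shift : ∀ d c p → PolyFn d c p → PolyFn d c (p ∘ suc)
PolyFn-shift zero    c p h x = h (suc x)
PolyFn-shift (suc d) c p h = PolyFn-shift d _ (Δ p) h

Δ-x* : ∀ p x → Δ (λ y → ι y * p y) x ≡ ι x * Δ p x + p (suc x)
Δ-x* p x = trans (cong (λ z → z * p (suc x) - ι x * p x) (ι-suc x))
  (solve 3 (λ i a b → (i :+ con 1ℚ) :* a :+ (:- (i :* b)) := i :* (a :+ (:- b)) :+ a) refl (ι x) (p (suc x)) (p x))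

PolyFn-x* : ∀ d c p → PolyFn d c p → PolyFn (suc d) c (λ x → ι x * p x)
PolyFn-x* zero    c p h x = trans (Δ-x* p x) (trans (cong₂ (λ a b → ι x * (a - b) + a) (h (suc x)) (h x))
  (trans (cong (λ z → ι x * z + c) (QP.+-inverseʳ c)) (trans (cong (_+ c) (*0 (ι x))) (trans (0+ c) (sym (QP.*-identityʳ c))))))
PolyFn-x* (suc d) c p h =
  PolyFn-cong (suc d) (c * ι (suc (suc d))) {p = λ x → ι x * Δ p x + p (suc x)} (λ x → sym (Δ-x* p x))
    (subst (λ k → PolyFn (suc d) k (λ x → ι x * Δ p x + p (suc x))) coefficient
      (PolyFn-+ (suc d) (c * ι (suc d)) c (λ x → ι x * Δ p x) (p ∘ suc)
        (PolyFn-x* d (c * ι (suc d)) (Δ p) h) (PolyFn-shift (suc d) c p h)))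
  where
  coefficient : c * ι (suc d) + c ≡ c * ι (suc (suc d))
  coefficient = trans (cong (c * ι (suc d) +_) (sym (QP.*-identityʳ c)))
                      (trans (sym (QP.*-distribˡ-+ c (ι (suc d)) 1ℚ)) (cong (c *_) (sym (ι-suc (suc d)))))

PolyFn-pow : ∀ k → PolyFn k 1ℚ (λ x → ι (x ^ k))
PolyFn-pow zero    x = refl
PolyFn-pow (suc k) = PolyFn-cong (suc k) 1ℚ (λ x → sym (ι-* x (x ^ k))) (PolyFn-x* k 1ℚ _ (PolyFn-pow k))

c·!-pos : ∀ d c → Positive c → Positive (c·! d c)
c·!-pos zero    c pc = pc
c·!-pos (suc d) c pc = c·!-pos d _ (QP.pos*pos⇒pos c {{pc}} (ι (suc d)) {{ι-pos d}})

oneMinusT⊛-zero : ∀ a → (oneMinusT ⊛ a) 0 ≡ a 0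
oneMinusT⊛-zero a = trans (0+ _) (QP.*-identityˡ (a 0))

oneMinusT⊛-suc : ∀ a N → (oneMinusT ⊛ a) (suc N) ≡ a (suc N) - a N
oneMinusT⊛-suc a N = trans (sumTo-peel (suc N) _) (trans (cong (λ z → 1ℚ * a (suc N) + z) (trans (sumTo-peel N _)
  (cong (λ z → - 1ℚ * a N + z) (sumTo-zero N (λ i _ → 0* (a (N ∸ suc i)))))))
  (solve 2 (λ x y → con 1ℚ :* x :+ (con (- 1ℚ) :* y :+ con 0ℚ) := x :+ (:- y)) refl (a (suc N)) (a N)))

oneMinusT^-iterΔ : ∀ r a m → (powP oneMinusT r ⊛ a) (m ℕ.+ r) ≡ iterΔ r a m
oneMinusT^-iterΔ zero    a m = trans (⊛-identityˡ a (m ℕ.+ 0)) (cong a (ℕP.+-identityʳ m))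
oneMinusT^-iterΔ (suc r) a m =
  trans (cong (powP oneMinusT (suc r) ⊛ a) (ℕP.+-suc m r))
  (trans (⊛-assoc oneMinusT (powP oneMinusT r) a (suc (m ℕ.+ r)))
  (trans (oneMinusT⊛-suc (powP oneMinusT r ⊛ a) (m ℕ.+ r))
         (cong₂ _-_ (oneMinusT^-iterΔ r a (suc m)) (oneMinusT^-iterΔ r a m))))

oneMinusT-telescope : ∀ n b → sumTo (suc n) (oneMinusT ⊛ b) ≡ b n
oneMinusT-telescope zero    b = trans (0+ _) (oneMinusT⊛-zero b)
oneMinusT-telescope (suc n) b = trans (cong₂ _+_ (oneMinusT-telescope n b) (oneMinusT⊛-suc b n))
  (solve 2 (λ x y → y :+ (x :+ (:- y)) := x) refl (b (suc n)) (b n))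

-- The Eulerian series for s = k + 1 ≥ 2:  D = t P_k(t) = (1-t)^s Σ_d d^k t^d.
module Eulerian (k′ : ℕ) where
  k = suc k′
  s = suc k
  D = powP oneMinusT s ⊛ eulSeries s

  eulSeries-PolyFn : PolyFn k 1ℚ (eulSeries s)
  eulSeries-PolyFn = PolyFn-cong k 1ℚ powers (PolyFn-pow k)
    where
    powers : ∀ x → ι (x ^ k) ≡ eulSeries s x
    powers zero    = refl
    powers (suc x) = refl

  D-zero : D 0 ≡ 0ℚ
  D-zero = trans (0+ _) (*0 (powP oneMinusT s 0))

  D-top : D s ≡ 0ℚ
  D-top = trans (oneMinusT^-iterΔ s (eulSeries s) 0) (PolyFn-iterΔ-suc k 1ℚ (eulSeries s) eulSeries-PolyFn 0)

  D-sum : sumTo (suc s) D ≡ c·! k 1ℚ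
  D-sum = trans (sumTo-ext (suc s) (⊛-assoc oneMinusT (powP oneMinusT k) (eulSeries s)))
    (trans (oneMinusT-telescope s (powP oneMinusT k ⊛ eulSeries s))
    (trans (oneMinusT^-iterΔ k (eulSeries s) 1) (PolyFn-iterΔ k 1ℚ (eulSeries s) eulSeries-PolyFn 1)))

coeff-tabulate-< : ∀ (h : ℕ → ℚ) g n i → i < n → coeff (map h (applyUpTo g n)) i ≡ h (g i)
coeff-tabulate-< h g (suc n) zero    _         = refl
coeff-tabulate-< h g (suc n) (suc i) (s≤s i<n) = coeff-tabulate-< h (g ∘ suc) n i i<n

coeff-tabulate-≥ : ∀ (h : ℕ → ℚ) g n i → n ≤ i → coeff (map h (applyUpTo g n)) i ≡ 0ℚ
coeff-tabulate-≥ h g zero    i       _         = refl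
coeff-tabulate-≥ h g (suc n) (suc i) (s≤s n≤i) = coeff-tabulate-≥ h (g ∘ suc) n i n≤i

evalAt1-tabulate : ∀ (h : ℕ → ℚ) g n → evalAt1 (map h (applyUpTo g n)) ≡ sumTo n (h ∘ g)
evalAt1-tabulate h g zero    = refl
evalAt1-tabulate h g (suc n) =
  trans (cong (h (g 0) +_) (evalAt1-tabulate h (g ∘ suc) n)) (sym (sumTo-peel n (h ∘ g)))

invFact : ℕ → ℚ
invFact s = ((ℤ.+ 1) / ((s ∸ 1) !)) {{(s ∸ 1) ℕP.!≢0}}

invFact-pos : ∀ s → Positive (invFact s)
invFact-pos s = QP.normalize-pos 1 ((s ∸ 1) !) {{(s ∸ 1) ℕP.!≢0}}

QE-coeff : ℕ → ℕ → ℚ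
QE-coeff s m = (powP oneMinusT s ⊛ eulSeries s) m * invFact s

QE-tabulate : ∀ s → QE s ≡ map (QE-coeff s) (upTo (suc s))
QE-tabulate s = sym (ListP.map-∘ (upTo (suc s)))

QE-admissible : Admissible QE
QE-admissible = record { vanishesAt0 = vanishesAt0 ; nonzeroAt1 = nonzeroAt1 ; degree< = degree< }
  where
  vanishesAt0 : ∀ s → 2 ≤ s → coeff (QE s) 0 ≡ 0ℚ
  vanishesAt0 (suc zero) (s≤s ())
  vanishesAt0 (suc (suc k′)) _ = begin
    coeff (QE s) 0                          ≡⟨ cong (λ L → coeff L 0) (QE-tabulate s) ⟩
    coeff (map (QE-coeff s) (upTo (suc s))) 0 ≡⟨ coeff-tabulate-< (QE-coeff s) id (suc s) 0 (s≤s z≤n) ⟩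
    Eulerian.D k′ 0 * invFact s             ≡⟨ cong (_* invFact s) (Eulerian.D-zero k′) ⟩
    0ℚ * invFact s                          ≡⟨ 0* (invFact s) ⟩
    0ℚ                                      ∎
    where
    open ≡-Reasoning
    s = suc (suc k′)
  nonzeroAt1 : ∀ s → 2 ≤ s → evalAt1 (QE s) ≢ 0ℚ
  nonzeroAt1 (suc zero) (s≤s ())
  nonzeroAt1 (suc (suc k′)) _ = subst (_≢ 0ℚ) (sym value) (pos⇒≢0 _ {{positive}})
    where
    s = suc (suc k′)
    value : evalAt1 (QE s) ≡ c·! (suc k′) 1ℚ * invFact s
    value = trans (cong evalAt1 (QE-tabulate s)) (trans (evalAt1-tabulate (QE-coeff s) id (suc s))
              (trans (sumTo-*r (suc s) (invFact s) (Eulerian.D k′)) (cong (_* invFact s) (Eulerian.D-sum k′))))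
    positive : Positive (c·! (suc k′) 1ℚ * invFact s)
    positive = QP.pos*pos⇒pos (c·! (suc k′) 1ℚ) {{c·!-pos (suc k′) 1ℚ _}} (invFact s) {{invFact-pos s}}
  degree< : ∀ s → 2 ≤ s → ∀ i → s ≤ i → coeff (QE s) i ≡ 0ℚ
  degree< (suc zero) (s≤s ())
  degree< (suc (suc k′)) _ i s≤i = trans (cong (λ L → coeff L i) (QE-tabulate s)) (top (i ℕP.≟ s))
    where
    s = suc (suc k′)
    top : Dec (i ≡ s) → coeff (map (QE-coeff s) (upTo (suc s))) i ≡ 0ℚ
    top (yes refl) = trans (coeff-tabulate-< (QE-coeff s) id (suc s) s ℕP.≤-refl)
                           (trans (cong (_* invFact s) (Eulerian.D-top k′)) (0* (invFact s)))
    top (no i≢s)   = coeff-tabulate-≥ (QE-coeff s) id (suc s) i (ℕP.≤∧≢⇒< s≤i (λ e → i≢s (sym e)))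

QO-degree : ∀ s i → s < i → coeff (QO s) i ≡ 0ℚ
QO-degree zero          (suc i)       _         = refl
QO-degree (suc zero)    (suc zero)    (s≤s ())
QO-degree (suc zero)    (suc (suc i)) _         = refl
QO-degree (suc (suc s)) (suc i)       (s≤s s<i) = QO-degree s i (ℕP.<-trans (ℕP.n<1+n s) s<i)

QO-at1-pos : ∀ s → Positive (evalAt1 (QO s))
QO-at1-pos zero          = _
QO-at1-pos (suc zero)    = _
QO-at1-pos (suc (suc s)) = subst Positive (sym (0+ (evalAt1 (QO s)))) (QO-at1-pos s)

QO-admissible : Admissible QO
QO-admissible = record { vanishesAt0 = vanishesAt0 ; nonzeroAt1 = λ s _ → pos⇒≢0 _ {{QO-at1-pos s}} ; degree< = degree< }
  where
  vanishesAt0 : ∀ s → 2 ≤ s → coeff (QO s) 0 ≡ 0ℚ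
  vanishesAt0 (suc zero) (s≤s ())
  vanishesAt0 (suc (suc s)) _ = refl
  degree< : ∀ s → 2 ≤ s → ∀ i → s ≤ i → coeff (QO s) i ≡ 0ℚ
  degree< (suc zero) (s≤s ())
  degree< (suc (suc s)) _ (suc i) (s≤s s<i) = QO-degree s i s<i

module _ {Q : ℕ → Poly} (adm : Admissible Q) where

  ZSpan⇒MDsharp : ∀ f → ZSpan Q f → MDsharp f
  ZSpan⇒MDsharp f z = ZCSpan⇒ZSpan QE-admissible (ZSpan⇒ZCSpan adm z)

  MDsharp⇒ZSpan : ∀ f → MDsharp f → ZSpan Q f
  MDsharp⇒ZSpan f z = ZCSpan⇒ZSpan adm (ZSpan⇒ZCSpan QE-admissible z)

mainTheorem3 :
    ((Q : ℕ → Poly) →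
       (∀ s → 2 ≤ s → coeff (Q s) 0 ≡ 0ℚ) →
       (∀ s → 2 ≤ s → evalAt1 (Q s) ≢ 0ℚ) →
       (∀ s → 2 ≤ s → ∀ k → s ≤ k → coeff (Q s) k ≡ 0ℚ) →
       ((∀ f → ZSpan Q f → MDsharp f) × (∀ f → MDsharp f → ZSpan Q f))
       × (∀ f → ZSpan Q f → MD f)
       × ZSpan Q oneP
       × (∀ f g → ZSpan Q f → ZSpan Q g → ZSpan Q (f ⊛ g)))
    × ((∀ f → qMZV f → MDsharp f) × (∀ f → MDsharp f → qMZV f))
    × (∀ f g → qMZV f → qMZV g → qMZV (f ⊛ g))
mainTheorem3 =
  (λ Q c0 ev dg →
     let adm : Admissible Q
         adm = record { vanishesAt0 = c0 ; nonzeroAt1 = ev ; degree< = dg }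
     in (ZSpan⇒MDsharp adm , MDsharp⇒ZSpan adm) ,
        (λ f z → MDsharp⇒MD f (ZSpan⇒MDsharp adm f z)) ,
        ZSpan-one Q ,
        ZSpan-⊛ adm) ,
  (ZSpan⇒MDsharp QO-admissible , MDsharp⇒ZSpan QO-admissible) ,
  ZSpan-⊛ QO-admissible
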